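{- For $n\ge1$ let $b(n)=\sum_D q^{\#\{+\text{'s in }D\}}$, summed over all $\Gamma$-diagrams $D$ of type $(B_n,n)$ of maximal shape $Q$, and let $b(0)=1$. Then for $n\ge 1$ $$b(n)=[n+1]\,b(n-1)+q^2\sum_{i=1}^{n-2}\frac{[n-1]^{(i)}}{i!}\,b(n-i-1),$$ where $[i]=1+q+\cdots+q^{i-1}$ and $[i]^{(k)}$ denotes the $k$-th derivative of $[i]$ with respect to $q$.
   Context: $W$: Weyl group of type $B_n$, simple reflections $s_1,\dots,s_n$ ($s_is_{i+1}$ of order 3 for $i\le n-2$, $s_{n-1}s_n$ of order 4, others commute; $W=\{1,s_1\}$ if $n=1$), Bruhat order $<$. $Q$: boxes $(r,c)$, $1\le r\le n$ (rows top to bottom), $1\le c\le n-r+1$, labeled $s_{r+c-1}$; order = transitive closure of $(r,c)\lessdot(r,c+1)$, $(r,c)\lessdot(r-1,c)$. An $\oplus$-diagram of shape $Q$ is $D:Q\to\{0,+\}$. For a linear extension $b_1,\dots,b_m$ of $Q$, $s_{i_t}:=s_{b_{m+1-t}}$, $t_t=s_{i_t}$ if $D(b_{m+1-t})=0$ and $1$ otherwise, $v_{(0)}=1$, $v_{(k)}=t_1\cdots t_k$; $D$ is a $\Gamma$-diagram if $v_{(k-1)}<v_{(k-1)}s_{i_k}$ for all $k$. -}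

module Defs where

open import Data.Nat using (ℕ; zero; suc; _+_; _*_; _∸_; _≤_; _<_; _<ᵇ_; _≡ᵇ_; _!; _/_)
open import Data.Nat.Properties using (_!≢0)
open import Data.Integer using (ℤ; +_; -_)
open import Data.Bool using (Bool; true; false; if_then_else_)
open import Data.List using (List; []; _∷_; _++_; length; map; foldl; reverse; upTo; downFrom; concatMap; zip)
open import Data.Nat.ListAction using (sum)
open import Data.List.Relation.Unary.All using (All)
open import Data.List.Relation.Unary.Unique.Propositional using (Unique)
open import Data.List.Membership.Propositional using (_∈_)
open import Data.Vec using (Vec; toList)
open import Data.Product using (Σ; ∃; _×_; _,_)
open import Data.Unit using (⊤)
open import Function.Bundles using (_⇔_)
open import Relation.Binary.PropositionalEquality using (_≡_)
open import Relation.Binary.Construct.Closure.Transitive using (TransClosure)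

-- The Weyl group W = W(B_n), realised as signed permutations of
-- {±1,…,±n} in window notation [w(1),…,w(n)] (a list of integers).
-- Right multiplication by the simple reflections:
--   w·s_i (1 ≤ i < n) swaps the entries in positions i and i+1,
--   w·s_n             negates the entry in position n.
-- Then s_i s_{i+1} has order 3 (i ≤ n-2), s_{n-1} s_n has order 4,
-- all other pairs commute, and for n = 1, W = {1, s_1}.

SPerm : Set
SPerm = List ℤ

idW : ℕ → SPerm
idW n = map (λ i → + suc i) (upTo n)

-- swap positions i and i+1 (0-indexed)
swapAt : ℕ → SPerm → SPerm
swapAt zero    (x ∷ y ∷ xs) = y ∷ x ∷ xs
swapAt zero    xs           = xs
swapAt (suc i) []           = []
swapAt (suc i) (x ∷ xs)     = x ∷ swapAt i xs

negLast : SPerm → SPerm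
negLast []           = []
negLast (x ∷ [])     = - x ∷ []
negLast (x ∷ y ∷ xs) = x ∷ negLast (y ∷ xs)

rmul : ℕ → ℕ → SPerm → SPerm
rmul n i w = if i <ᵇ n then swapAt (i ∸ 1) w else negLast w

ValidWord : ℕ → List ℕ → Set
ValidWord n u = All (λ i → 1 ≤ i × i ≤ n) u

_·[_]_ : SPerm → ℕ → List ℕ → SPerm
w ·[ n ] u = foldl (λ x i → rmul n i x) w u

evalW : ℕ → List ℕ → SPerm
evalW n u = idW n ·[ n ] u

Len : (n : ℕ) → SPerm → ℕ → Set
Len n w k =
  (Σ (List ℕ) λ u → ValidWord n u × length u ≡ k × evalW n u ≡ w) ×
  (∀ u → ValidWord n u → evalW n u ≡ w → k ≤ length u)

-- reflections: conjugates u s_i u⁻¹ of simple reflections; represented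
-- by the word  u ++ [i] ++ reverse u  (whose product is u s_i u⁻¹).
IsReflWord : ℕ → List ℕ → Set
IsReflWord n r = Σ (List ℕ) λ u → Σ ℕ λ i →
  ValidWord n u × (1 ≤ i × i ≤ n) × r ≡ u ++ (i ∷ reverse u)

BruhatStep : ℕ → SPerm → SPerm → Set
BruhatStep n x y = Σ (List ℕ) λ r → IsReflWord n r × y ≡ x ·[ n ] r ×
  Σ ℕ λ k → Σ ℕ λ m → Len n x k × Len n y m × k < m

Bruhat< : ℕ → SPerm → SPerm → Set
Bruhat< n = TransClosure (BruhatStep n)

-- The poset Q of type (B_n, n): boxes (r,c), 1 ≤ r ≤ n, 1 ≤ c ≤ n-r+1,
-- box (r,c) labelled s_{r+c-1}.  We fix the linear extension
-- b_1,…,b_m listing rows from bottom (r = n) to top (r = 1), each row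
-- left to right.  Reversed (b_m, b_{m-1}, …, b_1) this is: rows r = 1..n
-- from top to bottom, each row from right (c = n-r+1) to left (c = 1).

revLinExt : ℕ → List (ℕ × ℕ)
revLinExt n = concatMap (λ r → map (λ c → (r , c)) (map suc (downFrom (n ∸ r + 1))))
                        (map suc (upTo n))

label : ℕ × ℕ → ℕ
label (r , c) = r + c ∸ 1

boxes : ℕ → ℕ
boxes n = length (revLinExt n)

data Sym : Set where
  O  : Sym
  P  : Sym

-- An ⊕-diagram D : Q → {0,+}, given by its values listed along
-- revLinExt n, i.e. entry t is D(b_{m+1-t}).
Diagram : ℕ → Set
Diagram n = Vec Sym (boxes n)

-- Γ-condition: with v_(0) = 1 and v_(k) = v_(k-1) t_k, require
-- v_(k-1) < v_(k-1) s_{i_k} (Bruhat) for every k.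
GammaFrom : ℕ → SPerm → List (ℕ × Sym) → Set
GammaFrom n v []            = ⊤
GammaFrom n v ((i , O) ∷ l) = Bruhat< n v (rmul n i v) × GammaFrom n (rmul n i v) l
GammaFrom n v ((i , P) ∷ l) = Bruhat< n v (rmul n i v) × GammaFrom n v l

IsGamma : (n : ℕ) → Diagram n → Set
IsGamma n D = GammaFrom n (idW n) (zip (map label (revLinExt n)) (toList D))

plusCount : List Sym → ℕ
plusCount []      = 0
plusCount (O ∷ l) = plusCount l
plusCount (P ∷ l) = suc (plusCount l)

HasCount : {A : Set} → (A → Set) → ℕ → Set
HasCount {A} Pr c = Σ (List A) λ l → Unique l × (∀ x → (x ∈ l) ⇔ Pr x) × length l ≡ c

-- Polynomials in q with ℕ coefficients, as coefficient sequences.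

Poly : Set
Poly = ℕ → ℕ

_≈P_ : Poly → Poly → Set
p ≈P r = ∀ k → p k ≡ r k

_⊕_ : Poly → Poly → Poly
(p ⊕ r) k = p k + r k

_⊛_ : Poly → Poly → Poly
(p ⊛ r) k = sum (map (λ j → p j * r (k ∸ j)) (upTo (suc k)))

qpow : ℕ → Poly
qpow j k = if k ≡ᵇ j then 1 else 0

bracket : ℕ → Poly
bracket i k = if k <ᵇ i then 1 else 0

deriv : Poly → Poly
deriv p k = suc k * p (suc k)

derivN : ℕ → Poly → Poly
derivN zero    p = p
derivN (suc i) p = deriv (derivN i p)

-- coefficientwise division by i! (exact for p = [m]^{(i)})
divFact : ℕ → Poly → Poly
divFact i p k = _/_ (p k) (i !) {{i !≢0}}

sumP : List Poly → Poly
sumP []       = λ _ → 0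
sumP (p ∷ ps) = p ⊕ sumP ps

IsGammaGenPoly : ℕ → Poly → Set
IsGammaGenPoly n p = ∀ k → HasCount (λ (D : Diagram n) → IsGamma n D × plusCount (toList D) ≡ k) (p k)

recRHS : (ℕ → Poly) → ℕ → Poly
recRHS b n = (bracket (suc n) ⊛ b (n ∸ 1)) ⊕
  (qpow 2 ⊛ sumP (map (λ i → divFact i (derivN i (bracket (n ∸ 1))) ⊛ b (n ∸ i ∸ 1))
                      (map suc (upTo (n ∸ 2)))))

-- Realise B_n as signed permutations acting on positions. An explicit
-- length function ℓ shows that the Bruhat condition v < v·sᵢ of a
-- Γ-diagram is the ascent test v(i) ≺ v(i+1) (resp. v(n) > 0), so b(n) is
-- a sum over the fillings of the reading word of Q.  Filling the top row
-- (labels n, …, 1) sweeps the last entry of the window to the left; the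
-- remaining rows are the staircase of B_{n−1} acting on the other entries.
-- Started from an arbitrary signed permutation the count vanishes unless
-- all entries are positive, and then depends only on the number h of
-- left-to-right maxima.  This gives b(h+1) = b(h) + q (b(h) + ψ b h) for a
-- recursively defined ψ, and Pascal's rule for the Taylor coefficients
-- C(k+i, i) of [h] turns ψ b h into q Σᵢ [h]^{(i)}/i! · b(h−i).

module Submission where

open import Defs

open import Level using (0ℓ)
open import Function using (_∘_; id)
open import Function.Bundles using (Equivalence; _⇔_; mk⇔)
open import Data.Empty using (⊥)
open import Data.Unit using (⊤; tt)
open import Data.Product using (Σ; _×_; _,_; proj₁; proj₂)
open import Data.Sum using (_⊎_; inj₁; inj₂)
open import Data.Bool using (Bool; true; false; if_then_else_; T; not; _∧_; T?)
open import Data.Bool.Properties using (T-≡; T-∧; ∧-zeroʳ)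
open import Data.Nat
  using (ℕ; zero; suc; _+_; _*_; _∸_; _≤_; _<_; _<ᵇ_; _≡ᵇ_; z≤n; s≤s; _!; _/_)
open import Data.Nat.Properties
open import Data.Nat.Induction using (<-rec)
open import Data.Nat.DivMod using (0/n≡0)
open import Data.Nat.ListAction using (sum)
open import Data.Nat.Combinatorics using (_C_; nCk≡nPk/k!; nCn≡1; nCk+nC[k+1]≡[n+1]C[k+1])
  renaming (_P_ to _perm_)
open import Data.Nat.Combinatorics.Base using (_P′_)
open import Data.Nat.Tactic.RingSolver using (solve-∀)
open import Algebra.Properties.CommutativeSemigroup +-commutativeSemigroup
  using () renaming (interchange to +-interchange)
open import Data.Integer using (ℤ; +_; -[1+_]; -_; ∣_∣)
open import Data.Integer.Properties using (neg-involutive; ∣-i∣≡∣i∣)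
open import Data.List
  using (List; []; _∷_; _++_; length; map; upTo; applyUpTo; zip; filterᵇ; downFrom; concatMap;
         drop; initLast; _∷ʳ′_)
open import Data.List.Properties
  using (++-assoc; ++-identityʳ; map-applyUpTo; applyUpTo-∷ʳ; map-++; map-cong; map-∘; map-id;
         length-map; length-upTo; length-++; foldl-++; filter-++; filter-none;
         concatMap-cong; concatMap-map; map-concatMap)
open import Data.List.Relation.Unary.All using (All; []; _∷_)
import Data.List.Relation.Unary.All as All
import Data.List.Relation.Unary.All.Properties as All
open import Data.List.Relation.Unary.Any using (here)
open import Data.List.Relation.Unary.AllPairs using ([]; _∷_)
open import Data.List.Relation.Unary.Linked using (Linked; []; [-]; _∷_)
open import Data.List.Relation.Unary.Linked.Properties using (Linked⇒All)
open import Data.List.Relation.Unary.Sorted.TotalOrder.Properties using (↗↭↗⇒≋)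
open import Data.List.Relation.Unary.Unique.Propositional using (Unique)
import Data.List.Relation.Unary.Unique.Propositional.Properties as Unique
open import Data.List.Membership.Propositional using (_∈_)
open import Data.List.Membership.Propositional.Properties
  using (∈-map⁺; ∈-map⁻; ∈-++⁺ˡ; ∈-++⁺ʳ; ∈-filter⁺; ∈-filter⁻)
open import Data.List.Membership.Propositional.Properties.WithK using (unique∧set⇒bag)
open import Data.List.Relation.Binary.BagAndSetEquality using (∼bag⇒↭)
open import Data.List.Relation.Binary.Permutation.Propositional
  using (_↭_; ↭-refl; ↭-prep; ↭-swap; ↭-trans; ↭-reflexive; ↭⇒↭ₛ)
open import Data.List.Relation.Binary.Permutation.Propositional.Properties using (∈-resp-↭; ↭-length)
open import Data.List.Relation.Binary.Pointwise using (Pointwise-≡⇒≡)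
open import Data.Vec using (Vec)
import Data.Vec as Vec
open import Data.Vec.Properties using (∷-injectiveʳ)
open import Relation.Nullary using (contradiction)
open import Relation.Binary.Bundles using (Setoid)
open import Relation.Binary.Structures using (IsEquivalence)
open import Relation.Binary.PropositionalEquality
import Relation.Binary.Reasoning.Setoid as SetoidReasoning
open import Relation.Binary.Construct.Closure.Transitive using ([_]; _∷_)

0ₚ : Poly
0ₚ _ = 0

1ₚ : Poly
1ₚ = qpow 0

infix 25 q·_

q·_ : Poly → Poly
(q· p) zero    = 0
(q· p) (suc k) = p k

≈P-isEquivalence : IsEquivalence _≈P_
≈P-isEquivalence = record
  { refl  = λ _ → refl
  ; sym   = λ e k → sym (e k)
  ; trans = λ e f k → trans (e k) (f k)
  }

Poly-setoid : Setoid 0ℓ 0ℓ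
Poly-setoid = record { isEquivalence = ≈P-isEquivalence }

open IsEquivalence ≈P-isEquivalence public
  using () renaming (refl to ≈P-refl; sym to ≈P-sym; trans to ≈P-trans; reflexive to ≈P-reflexive)

module ≈P-Reasoning = SetoidReasoning Poly-setoid

⊕-cong : ∀ {p p′ r r′} → p ≈P p′ → r ≈P r′ → (p ⊕ r) ≈P (p′ ⊕ r′)
⊕-cong e f k = cong₂ _+_ (e k) (f k)

⊕-congˡ : ∀ p {r r′} → r ≈P r′ → (p ⊕ r) ≈P (p ⊕ r′)
⊕-congˡ p = ⊕-cong (≈P-refl {p})

⊕-congʳ : ∀ r {p p′} → p ≈P p′ → (p ⊕ r) ≈P (p′ ⊕ r)
⊕-congʳ r e = ⊕-cong e (≈P-refl {r})

⊕-assoc : ∀ p r s → ((p ⊕ r) ⊕ s) ≈P (p ⊕ (r ⊕ s))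
⊕-assoc p r s k = +-assoc (p k) (r k) (s k)

⊕-identityʳ : ∀ p → (p ⊕ 0ₚ) ≈P p
⊕-identityʳ p k = +-identityʳ (p k)

q·-cong : ∀ {p r} → p ≈P r → q· p ≈P q· r
q·-cong e zero    = refl
q·-cong e (suc k) = e k

q·-zero : q· 0ₚ ≈P 0ₚ
q·-zero zero    = refl
q·-zero (suc k) = refl

q·-distrib-⊕ : ∀ p r → q· (p ⊕ r) ≈P (q· p ⊕ q· r)
q·-distrib-⊕ p r zero    = refl
q·-distrib-⊕ p r (suc k) = refl

private
  sum-zeros : ∀ {A : Set} (l : List A) → sum (map (λ _ → 0) l) ≡ 0
  sum-zeros []      = refl
  sum-zeros (x ∷ l) = sum-zeros l

  sum-upTo-suc : ∀ (f : ℕ → ℕ) k → sum (map f (upTo (suc k))) ≡ f 0 + sum (map (f ∘ suc) (upTo k))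
  sum-upTo-suc f k = cong (λ l → f 0 + sum l)
    (trans (map-applyUpTo suc f k) (sym (map-applyUpTo (λ x → x) (f ∘ suc) k)))

  sum-map-+ : ∀ (f g : ℕ → ℕ) l → sum (map (λ j → f j + g j) l) ≡ sum (map f l) + sum (map g l)
  sum-map-+ f g []      = refl
  sum-map-+ f g (x ∷ l) =
    trans (cong (_+_ (f x + g x)) (sum-map-+ f g l)) (+-interchange (f x) (g x) _ _)

⊛-cong : ∀ {p p′ r r′} → p ≈P p′ → r ≈P r′ → (p ⊛ r) ≈P (p′ ⊛ r′)
⊛-cong e f k = cong sum (map-cong (λ j → cong₂ _*_ (e j) (f (k ∸ j))) (upTo (suc k)))

⊛-congˡ : ∀ p {r r′} → r ≈P r′ → (p ⊛ r) ≈P (p ⊛ r′)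
⊛-congˡ p = ⊛-cong (≈P-refl {p})

⊛-congʳ : ∀ r {p p′} → p ≈P p′ → (p ⊛ r) ≈P (p′ ⊛ r)
⊛-congʳ r e = ⊛-cong e (≈P-refl {r})

⊛-distribʳ-⊕ : ∀ p p′ r → ((p ⊕ p′) ⊛ r) ≈P ((p ⊛ r) ⊕ (p′ ⊛ r))
⊛-distribʳ-⊕ p p′ r k =
  trans (cong sum (map-cong (λ j → *-distribʳ-+ (r (k ∸ j)) (p j) (p′ j)) (upTo (suc k))))
        (sum-map-+ (λ j → p j * r (k ∸ j)) (λ j → p′ j * r (k ∸ j)) (upTo (suc k)))

⊛-zeroˡ : ∀ r → (0ₚ ⊛ r) ≈P 0ₚ
⊛-zeroˡ r k = sum-zeros (upTo (suc k))

⊛-identityˡ : ∀ r → (1ₚ ⊛ r) ≈P r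
⊛-identityˡ r k = begin
  sum (map (λ j → 1ₚ j * r (k ∸ j)) (upTo (suc k)))   ≡⟨ sum-upTo-suc (λ j → 1ₚ j * r (k ∸ j)) k ⟩
  r k + 0 + sum (map (λ _ → 0) (upTo k))              ≡⟨ cong₂ _+_ (+-identityʳ (r k)) (sum-zeros (upTo k)) ⟩
  r k + 0                                             ≡⟨ +-identityʳ (r k) ⟩
  r k                                                 ∎
  where open ≡-Reasoning

q·-⊛ : ∀ p r → (q· p ⊛ r) ≈P q· (p ⊛ r)
q·-⊛ p r zero    = refl
q·-⊛ p r (suc k) = sum-upTo-suc (λ j → (q· p) j * r (suc k ∸ j)) (suc k)

sumP-++ : ∀ ps rs → sumP (ps ++ rs) ≈P (sumP ps ⊕ sumP rs)
sumP-++ []       rs k = refl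
sumP-++ (p ∷ ps) rs k = trans (cong (_+_ (p k)) (sumP-++ ps rs k)) (sym (+-assoc (p k) _ _))

sumP-map-cong : ∀ {f g : ℕ → Poly} → (∀ i → f i ≈P g i) → ∀ l → sumP (map f l) ≈P sumP (map g l)
sumP-map-cong e []      = ≈P-refl
sumP-map-cong e (x ∷ l) = ⊕-cong (e x) (sumP-map-cong e l)

sumP-map-⊕ : ∀ (f g : ℕ → Poly) l → sumP (map (λ i → f i ⊕ g i) l) ≈P (sumP (map f l) ⊕ sumP (map g l))
sumP-map-⊕ f g []      k = refl
sumP-map-⊕ f g (x ∷ l) k =
  trans (cong (_+_ (f x k + g x k)) (sumP-map-⊕ f g l k)) (+-interchange (f x k) (g x k) _ _)

sumP-map-q· : ∀ (f : ℕ → Poly) l → sumP (map (λ i → q· f i) l) ≈P q· sumP (map f l)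
sumP-map-q· f []      zero    = refl
sumP-map-q· f []      (suc k) = refl
sumP-map-q· f (x ∷ l) zero    = sumP-map-q· f l zero
sumP-map-q· f (x ∷ l) (suc k) = cong (_+_ (f x k)) (sumP-map-q· f l (suc k))

sumUpTo : (ℕ → Poly) → ℕ → Poly
sumUpTo f h = sumP (map f (upTo h))

sumUpTo-sucˡ : ∀ f h → sumUpTo f (suc h) ≈P (f 0 ⊕ sumUpTo (f ∘ suc) h)
sumUpTo-sucˡ f h k = cong (λ l → f 0 k + sumP l k)
  (trans (map-applyUpTo suc f h) (sym (map-applyUpTo (λ x → x) (f ∘ suc) h)))

sumUpTo-sucʳ : ∀ f h → sumUpTo f (suc h) ≈P (sumUpTo f h ⊕ f h)
sumUpTo-sucʳ f h = begin
  sumP (map f (upTo (suc h)))          ≡⟨ cong (sumP ∘ map f) (applyUpTo-∷ʳ (λ x → x) h) ⟨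
  sumP (map f (upTo h ++ h ∷ []))      ≡⟨ cong sumP (map-++ f (upTo h) (h ∷ [])) ⟩
  sumP (map f (upTo h) ++ f h ∷ [])    ≈⟨ sumP-++ (map f (upTo h)) (f h ∷ []) ⟩
  sumUpTo f h ⊕ (f h ⊕ 0ₚ)             ≈⟨ ⊕-cong ≈P-refl (⊕-identityʳ (f h)) ⟩
  sumUpTo f h ⊕ f h                    ∎
  where open ≈P-Reasoning

sumUpTo-cong : ∀ {f g} h → (∀ i → i < h → f i ≈P g i) → sumUpTo f h ≈P sumUpTo g h
sumUpTo-cong zero    e = ≈P-refl
sumUpTo-cong {f} {g} (suc h) e = begin
  sumUpTo f (suc h)   ≈⟨ sumUpTo-sucʳ f h ⟩
  sumUpTo f h ⊕ f h   ≈⟨ ⊕-cong (sumUpTo-cong h (λ i i<h → e i (m<n⇒m<1+n i<h))) (e h ≤-refl) ⟩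
  sumUpTo g h ⊕ g h   ≈⟨ sumUpTo-sucʳ g h ⟨
  sumUpTo g (suc h)   ∎
  where open ≈P-Reasoning

<ᵇ≡true⇒< : ∀ {m n} → (m <ᵇ n) ≡ true → m < n
<ᵇ≡true⇒< {m} {n} e = <ᵇ⇒< m n (subst T (sym e) tt)

<ᵇ≡false⇒≥ : ∀ {m n} → (m <ᵇ n) ≡ false → n ≤ m
<ᵇ≡false⇒≥ e = ≮⇒≥ (λ m<n → subst T e (<⇒<ᵇ m<n))

<⇒<ᵇ≡true : ∀ {m n} → m < n → (m <ᵇ n) ≡ true
<⇒<ᵇ≡true m<n = Equivalence.to T-≡ (<⇒<ᵇ m<n)

≥⇒<ᵇ≡false : ∀ {m n} → n ≤ m → (m <ᵇ n) ≡ false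
≥⇒<ᵇ≡false {m} {n} n≤m with m <ᵇ n in e
... | false = refl
... | true  = contradiction n≤m (<⇒≱ (<ᵇ≡true⇒< e))

-- Taylor coefficients of [h]

taylor : ℕ → ℕ → Poly
taylor h i k = if k + i <ᵇ h then (k + i) C i else 0

private
  perm≡P′ : ∀ {i n} → i ≤ n → n perm i ≡ n P′ i
  perm≡P′ {i} {n} i≤n rewrite Equivalence.to T-≡ (≤⇒≤ᵇ i≤n) = refl

derivN-coeff : ∀ i p k → derivN i p k ≡ ((k + i) P′ i) * p (k + i)
derivN-coeff zero    p k rewrite +-identityʳ k = sym (+-identityʳ (p k))
derivN-coeff (suc i) p k = begin
  suc k * derivN i p (suc k)                             ≡⟨ cong (suc k *_) (derivN-coeff i p (suc k)) ⟩
  suc k * (((suc k + i) P′ i) * p (suc k + i))           ≡⟨ *-assoc (suc k) ((suc k + i) P′ i) (p (suc k + i)) ⟨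
  suc k * ((suc k + i) P′ i) * p (suc k + i)             ≡⟨ cong (λ m → m * ((suc k + i) P′ i) * p (suc k + i)) (m+n∸n≡m (suc k) i) ⟨
  (suc k + i ∸ i) * ((suc k + i) P′ i) * p (suc k + i)   ≡⟨ cong (λ n → (n P′ suc i) * p n) (+-suc k i) ⟨
  ((k + suc i) P′ suc i) * p (k + suc i)                 ∎
  where open ≡-Reasoning

taylor≈divFact-derivN : ∀ h i → divFact i (derivN i (bracket h)) ≈P taylor h i
taylor≈divFact-derivN h i k rewrite derivN-coeff i (bracket h) k with k + i <ᵇ h
... | true  = begin
  (((k + i) P′ i) * 1) / i !   ≡⟨ cong (_/ i !) (*-identityʳ ((k + i) P′ i)) ⟩
  ((k + i) P′ i) / i !         ≡⟨ cong (_/ i !) (perm≡P′ (m≤n+m i k)) ⟨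
  ((k + i) perm i) / i !       ≡⟨ nCk≡nPk/k! (m≤n+m i k) ⟨
  (k + i) C i                  ∎
  where open ≡-Reasoning
        instance _ = i !≢0
... | false = trans (cong (λ m → (m / i !) {{i !≢0}}) (*-zeroʳ ((k + i) P′ i))) (0/n≡0 (i !) {{i !≢0}})

taylor-pascal : ∀ h i → taylor (suc h) (suc i) ≈P (taylor h i ⊕ q· taylor h (suc i))
taylor-pascal h i zero with i <ᵇ h
... | true  = trans (nCn≡1 (suc i)) (trans (sym (nCn≡1 i)) (sym (+-identityʳ _)))
... | false = refl
taylor-pascal h i (suc k) rewrite +-suc k i with suc (k + i) <ᵇ h
... | true  = sym (nCk+nC[k+1]≡[n+1]C[k+1] (suc (k + i)) i)
... | false = refl

taylor-zero-suc : ∀ h → taylor (suc h) 0 ≈P (1ₚ ⊕ q· taylor h 0)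
taylor-zero-suc h zero    = refl
taylor-zero-suc h (suc k) rewrite +-identityʳ k with k <ᵇ h
... | true  = refl
... | false = refl

taylor-diagonal : ∀ h → taylor h h ≈P 0ₚ
taylor-diagonal h k rewrite ≥⇒<ᵇ≡false (m≤n+m h k) = refl

bracket≈taylor-zero : ∀ h → bracket h ≈P taylor h 0
bracket≈taylor-zero h k rewrite +-identityʳ k = refl

-- The recurrence of ψ and its closed form

ψ : (ℕ → Poly) → ℕ → Poly
ψ g zero    = 0ₚ
ψ g (suc h) = ψ g h ⊕ q· (g (suc h) ⊕ ψ (g ∘ suc) h)

taylorConv : (ℕ → Poly) → ℕ → Poly
taylorConv g h = sumUpTo (λ i → taylor h i ⊛ g (h ∸ i)) h

private
  taylorConv-shift : ∀ (g : ℕ → Poly) h →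
    ((taylor h 0 ⊛ g (suc h)) ⊕ sumUpTo (λ i → taylor h (suc i) ⊛ g (h ∸ i)) h) ≈P taylorConv (g ∘ suc) h
  taylorConv-shift g zero k = trans (+-identityʳ _) (⊛-zeroˡ (g 1) k)
  taylorConv-shift g (suc h) = begin
    lead ⊕ sumUpTo f (suc h)       ≈⟨ ⊕-congˡ lead (sumUpTo-sucʳ f h) ⟩
    lead ⊕ (sumUpTo f h ⊕ f h)     ≈⟨ ⊕-congˡ lead (⊕-cong (sumUpTo-cong h f≈f′) last≈0) ⟩
    lead ⊕ (sumUpTo f′ h ⊕ 0ₚ)     ≈⟨ ⊕-congˡ lead (⊕-identityʳ (sumUpTo f′ h)) ⟩
    lead ⊕ sumUpTo f′ h            ≈⟨ sumUpTo-sucˡ (λ i → taylor (suc h) i ⊛ g (suc (suc h ∸ i))) h ⟨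
    taylorConv (g ∘ suc) (suc h)   ∎
    where
    open ≈P-Reasoning
    lead = taylor (suc h) 0 ⊛ g (suc (suc h))
    f f′ : ℕ → Poly
    f  i = taylor (suc h) (suc i) ⊛ g (suc h ∸ i)
    f′ i = taylor (suc h) (suc i) ⊛ g (suc (h ∸ i))
    f≈f′ : ∀ i → i < h → f i ≈P f′ i
    f≈f′ i i<h = ⊛-congˡ (taylor (suc h) (suc i)) (λ k → cong (λ j → g j k) (+-∸-assoc 1 (<⇒≤ i<h)))
    last≈0 : f h ≈P 0ₚ
    last≈0 = ≈P-trans (⊛-congʳ (g (suc h ∸ h)) (taylor-diagonal (suc h))) (⊛-zeroˡ (g (suc h ∸ h)))

  rearrange : ∀ x a t b → ((x ⊕ q· a) ⊕ (t ⊕ q· b)) ≈P (t ⊕ (x ⊕ q· (a ⊕ b)))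
  rearrange x a t b zero    = identity (x 0) (t 0)
    where
    identity : ∀ x t → x + 0 + (t + 0) ≡ t + (x + 0)
    identity = solve-∀
  rearrange x a t b (suc k) = identity (x (suc k)) (a k) (t (suc k)) (b k)
    where
    identity : ∀ x a t b → x + a + (t + b) ≡ t + (x + (a + b))
    identity = solve-∀

taylorConv-suc : ∀ (g : ℕ → Poly) h →
  taylorConv g (suc h) ≈P (taylorConv g h ⊕ (g (suc h) ⊕ q· taylorConv (g ∘ suc) h))
taylorConv-suc g h = begin
  taylorConv g (suc h)
    ≈⟨ sumUpTo-sucˡ (λ i → taylor (suc h) i ⊛ g (suc h ∸ i)) h ⟩
  (taylor (suc h) 0 ⊛ g (suc h)) ⊕ sumUpTo (λ i → taylor (suc h) (suc i) ⊛ g (h ∸ i)) h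
    ≈⟨ ⊕-cong leading (sumUpTo-cong h (λ i _ → pascal i)) ⟩
  (g (suc h) ⊕ q· a) ⊕ sumUpTo (λ i → (taylor h i ⊛ g (h ∸ i)) ⊕ q· (taylor h (suc i) ⊛ g (h ∸ i))) h
    ≈⟨ ⊕-congˡ (g (suc h) ⊕ q· a) (sumP-map-⊕ (λ i → taylor h i ⊛ g (h ∸ i)) (λ i → q· (taylor h (suc i) ⊛ g (h ∸ i))) (upTo h)) ⟩
  (g (suc h) ⊕ q· a) ⊕ (taylorConv g h ⊕ sumUpTo (λ i → q· (taylor h (suc i) ⊛ g (h ∸ i))) h)
    ≈⟨ ⊕-congˡ (g (suc h) ⊕ q· a) (⊕-congˡ (taylorConv g h) (sumP-map-q· (λ i → taylor h (suc i) ⊛ g (h ∸ i)) (upTo h))) ⟩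
  (g (suc h) ⊕ q· a) ⊕ (taylorConv g h ⊕ q· b)
    ≈⟨ rearrange (g (suc h)) a (taylorConv g h) b ⟩
  taylorConv g h ⊕ (g (suc h) ⊕ q· (a ⊕ b))
    ≈⟨ ⊕-congˡ (taylorConv g h) (⊕-congˡ (g (suc h)) (q·-cong (taylorConv-shift g h))) ⟩
  taylorConv g h ⊕ (g (suc h) ⊕ q· taylorConv (g ∘ suc) h)
    ∎
  where
  open ≈P-Reasoning
  a = taylor h 0 ⊛ g (suc h)
  b = sumUpTo (λ i → taylor h (suc i) ⊛ g (h ∸ i)) h
  leading : (taylor (suc h) 0 ⊛ g (suc h)) ≈P (g (suc h) ⊕ q· a)
  leading = begin
    taylor (suc h) 0 ⊛ g (suc h)                     ≈⟨ ⊛-congʳ (g (suc h)) (taylor-zero-suc h) ⟩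
    (1ₚ ⊕ q· taylor h 0) ⊛ g (suc h)                 ≈⟨ ⊛-distribʳ-⊕ 1ₚ (q· taylor h 0) (g (suc h)) ⟩
    (1ₚ ⊛ g (suc h)) ⊕ (q· taylor h 0 ⊛ g (suc h))   ≈⟨ ⊕-cong (⊛-identityˡ (g (suc h))) (q·-⊛ (taylor h 0) (g (suc h))) ⟩
    g (suc h) ⊕ q· a                                 ∎
  pascal : ∀ i → (taylor (suc h) (suc i) ⊛ g (h ∸ i)) ≈P
                 ((taylor h i ⊛ g (h ∸ i)) ⊕ q· (taylor h (suc i) ⊛ g (h ∸ i)))
  pascal i = begin
    taylor (suc h) (suc i) ⊛ g (h ∸ i)                          ≈⟨ ⊛-congʳ (g (h ∸ i)) (taylor-pascal h i) ⟩
    (taylor h i ⊕ q· taylor h (suc i)) ⊛ g (h ∸ i)              ≈⟨ ⊛-distribʳ-⊕ (taylor h i) (q· taylor h (suc i)) (g (h ∸ i)) ⟩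
    (taylor h i ⊛ g (h ∸ i)) ⊕ (q· taylor h (suc i) ⊛ g (h ∸ i)) ≈⟨ ⊕-congˡ (taylor h i ⊛ g (h ∸ i)) (q·-⊛ (taylor h (suc i)) (g (h ∸ i))) ⟩
    (taylor h i ⊛ g (h ∸ i)) ⊕ q· (taylor h (suc i) ⊛ g (h ∸ i)) ∎

ψ≈q·taylorConv : ∀ (g : ℕ → Poly) h → ψ g h ≈P q· taylorConv g h
ψ≈q·taylorConv g zero    = ≈P-sym q·-zero
ψ≈q·taylorConv g (suc h) = begin
  ψ g h ⊕ q· (g (suc h) ⊕ ψ (g ∘ suc) h)
    ≈⟨ ⊕-cong (ψ≈q·taylorConv g h) (q·-cong (⊕-congˡ (g (suc h)) (ψ≈q·taylorConv (g ∘ suc) h))) ⟩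
  q· taylorConv g h ⊕ q· (g (suc h) ⊕ q· taylorConv (g ∘ suc) h)
    ≈⟨ q·-distrib-⊕ (taylorConv g h) (g (suc h) ⊕ q· taylorConv (g ∘ suc) h) ⟨
  q· (taylorConv g h ⊕ (g (suc h) ⊕ q· taylorConv (g ∘ suc) h))
    ≈⟨ q·-cong (taylorConv-suc g h) ⟨
  q· taylorConv g (suc h)
    ∎
  where open ≈P-Reasoning

recRHS-cong : ∀ {b b′} → (∀ n → b n ≈P b′ n) → ∀ n → recRHS b n ≈P recRHS b′ n
recRHS-cong e n = ⊕-cong (⊛-congˡ (bracket (suc n)) (e (n ∸ 1)))
  (⊛-congˡ (qpow 2) (sumP-map-cong (λ i → ⊛-congˡ (divFact i (derivN i (bracket (n ∸ 1)))) (e (n ∸ i ∸ 1)))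
                                   (map suc (upTo (n ∸ 2)))))

private
  derivativeSum : (ℕ → Poly) → ℕ → Poly
  derivativeSum b h =
    sumP (map (λ i → divFact i (derivN i (bracket h)) ⊛ b (suc h ∸ i ∸ 1)) (map suc (upTo (h ∸ 1))))

  taylorConv-split : ∀ (b : ℕ → Poly) h → taylorConv b h ≈P ((bracket h ⊛ b h) ⊕ derivativeSum b h)
  taylorConv-split b zero    k = trans (sym (⊛-zeroˡ (b 0) k)) (sym (+-identityʳ _))
  taylorConv-split b (suc h) = begin
    taylorConv b (suc h)
      ≈⟨ sumUpTo-sucˡ (λ i → taylor (suc h) i ⊛ b (suc h ∸ i)) h ⟩
    (taylor (suc h) 0 ⊛ b (suc h)) ⊕ sumUpTo (λ i → taylor (suc h) (suc i) ⊛ b (h ∸ i)) h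
      ≈⟨ ⊕-cong (⊛-congʳ (b (suc h)) (≈P-sym (bracket≈taylor-zero (suc h))))
                (sumP-map-cong term (upTo h)) ⟩
    (bracket (suc h) ⊛ b (suc h)) ⊕ sumP (map (f ∘ suc) (upTo h))
      ≡⟨ cong (λ l → (bracket (suc h) ⊛ b (suc h)) ⊕ sumP l) (map-∘ (upTo h)) ⟩
    (bracket (suc h) ⊛ b (suc h)) ⊕ derivativeSum b (suc h)
      ∎
    where
    open ≈P-Reasoning
    f : ℕ → Poly
    f i = divFact i (derivN i (bracket (suc h))) ⊛ b (suc (suc h) ∸ i ∸ 1)
    term : ∀ i → (taylor (suc h) (suc i) ⊛ b (h ∸ i)) ≈P f (suc i)
    term i = ⊛-cong (≈P-sym (taylor≈divFact-derivN (suc h) (suc i)))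
                    (λ k → cong (λ j → b j k) (sym (trans (∸-+-assoc (suc h) i 1) (cong (suc h ∸_) (+-comm i 1)))))

  bracket-suc-suc : ∀ h → bracket (suc (suc h)) ≈P (1ₚ ⊕ q· (1ₚ ⊕ q· bracket h))
  bracket-suc-suc h zero          = refl
  bracket-suc-suc h (suc zero)    = refl
  bracket-suc-suc h (suc (suc k)) = refl

  qpow2⊛ : ∀ p → (qpow 2 ⊛ p) ≈P q· q· p
  qpow2⊛ p = begin
    qpow 2 ⊛ p       ≈⟨ ⊛-congʳ p q² ⟩
    q· q· 1ₚ ⊛ p     ≈⟨ q·-⊛ (q· 1ₚ) p ⟩
    q· (q· 1ₚ ⊛ p)   ≈⟨ q·-cong (q·-⊛ 1ₚ p) ⟩
    q· q· (1ₚ ⊛ p)   ≈⟨ q·-cong (q·-cong (⊛-identityˡ p)) ⟩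
    q· q· p          ∎
    where
    open ≈P-Reasoning
    q² : qpow 2 ≈P q· q· 1ₚ
    q² zero          = refl
    q² (suc zero)    = refl
    q² (suc (suc k)) = refl

recRHS-suc : ∀ (b : ℕ → Poly) h → recRHS b (suc h) ≈P (b h ⊕ q· (b h ⊕ ψ b h))
recRHS-suc b h = begin
  (bracket (suc (suc h)) ⊛ b h) ⊕ (qpow 2 ⊛ D)
    ≈⟨ ⊕-cong (⊛-congʳ (b h) (bracket-suc-suc h)) (qpow2⊛ D) ⟩
  ((1ₚ ⊕ q· (1ₚ ⊕ q· bracket h)) ⊛ b h) ⊕ q· q· D
    ≈⟨ ⊕-congʳ (q· q· D) expand ⟩
  (b h ⊕ q· (b h ⊕ q· C)) ⊕ q· q· D
    ≈⟨ collect ⟩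
  b h ⊕ q· (b h ⊕ q· (C ⊕ D))
    ≈⟨ ⊕-congˡ (b h) (q·-cong (⊕-congˡ (b h) (q·-cong (taylorConv-split b h)))) ⟨
  b h ⊕ q· (b h ⊕ q· taylorConv b h)
    ≈⟨ ⊕-congˡ (b h) (q·-cong (⊕-congˡ (b h) (ψ≈q·taylorConv b h))) ⟨
  b h ⊕ q· (b h ⊕ ψ b h)
    ∎
  where
  open ≈P-Reasoning
  C = bracket h ⊛ b h
  D = derivativeSum b h
  unit : ∀ p → ((1ₚ ⊕ q· p) ⊛ b h) ≈P (b h ⊕ q· (p ⊛ b h))
  unit p = ≈P-trans (⊛-distribʳ-⊕ 1ₚ (q· p) (b h)) (⊕-cong (⊛-identityˡ (b h)) (q·-⊛ p (b h)))
  expand : ((1ₚ ⊕ q· (1ₚ ⊕ q· bracket h)) ⊛ b h) ≈P (b h ⊕ q· (b h ⊕ q· C))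
  expand = ≈P-trans (unit (1ₚ ⊕ q· bracket h)) (⊕-congˡ (b h) (q·-cong (unit (bracket h))))
  collect : ((b h ⊕ q· (b h ⊕ q· C)) ⊕ q· q· D) ≈P (b h ⊕ q· (b h ⊕ q· (C ⊕ D)))
  collect zero          = +-identityʳ _
  collect (suc zero)    = +-identityʳ _
  collect (suc (suc k)) = trans (+-assoc (b h (suc (suc k))) (b h (suc k) + C k) (D k))
                                (cong (_+_ (b h (suc (suc k)))) (+-assoc (b h (suc k)) (C k) (D k)))

-- The order 0 ≺ 1 ≺ 2 ≺ ⋯ ≺ −2 ≺ −1 on ℤ: w·sᵢ is longer than w iff
-- w(i) ≺ w(i+1) (for i < n), resp. w(n) > 0 (for i = n).
infix 4 _≺ᵇ_

_≺ᵇ_ : ℤ → ℤ → Bool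
+ a      ≺ᵇ + b      = a <ᵇ b
+ a      ≺ᵇ -[1+ b ] = true
-[1+ a ] ≺ᵇ + b      = false
-[1+ a ] ≺ᵇ -[1+ b ] = b <ᵇ a

isNonNeg : ℤ → Bool
isNonNeg (+ _)    = true
isNonNeg -[1+ _ ] = false

-- w·sᵢ where sᵢ is a sign change when i is the last position: unlike rmul,
-- the rank is read off the length of w.
mulS : ℕ → List ℤ → List ℤ
mulS zero          w           = w
mulS (suc zero)    []          = []
mulS (suc zero)    (x ∷ [])    = - x ∷ []
mulS (suc zero)    (x ∷ y ∷ w) = y ∷ x ∷ w
mulS (suc (suc i)) []          = []
mulS (suc (suc i)) (x ∷ w)     = x ∷ mulS (suc i) w

ascentᵇ : ℕ → List ℤ → Bool
ascentᵇ zero          w           = false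
ascentᵇ (suc zero)    []          = false
ascentᵇ (suc zero)    (x ∷ [])    = isNonNeg x
ascentᵇ (suc zero)    (x ∷ y ∷ w) = x ≺ᵇ y
ascentᵇ (suc (suc i)) []          = false
ascentᵇ (suc (suc i)) (x ∷ w)     = ascentᵇ (suc i) w

descentᵇ : ℕ → List ℤ → Bool
descentᵇ zero          w           = false
descentᵇ (suc zero)    []          = false
descentᵇ (suc zero)    (x ∷ [])    = not (isNonNeg x)
descentᵇ (suc zero)    (x ∷ y ∷ w) = y ≺ᵇ x
descentᵇ (suc (suc i)) []          = false
descentᵇ (suc (suc i)) (x ∷ w)     = descentᵇ (suc i) w

data Nonzero : ℤ → Set where
  nz⁺ : ∀ a → Nonzero (+ suc a)
  nz⁻ : ∀ a → Nonzero -[1+ a ]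

data Positive : ℤ → Set where
  pos : ∀ a → Positive (+ suc a)

length-mulS : ∀ i w → length (mulS i w) ≡ length w
length-mulS zero          w           = refl
length-mulS (suc zero)    []          = refl
length-mulS (suc zero)    (x ∷ [])    = refl
length-mulS (suc zero)    (x ∷ y ∷ w) = refl
length-mulS (suc (suc i)) []          = refl
length-mulS (suc (suc i)) (x ∷ w)     = cong suc (length-mulS (suc i) w)

mulS-involutive : ∀ i w → mulS i (mulS i w) ≡ w
mulS-involutive zero          w           = refl
mulS-involutive (suc zero)    []          = refl
mulS-involutive (suc zero)    (x ∷ [])    = cong (_∷ []) (neg-involutive x)
mulS-involutive (suc zero)    (x ∷ y ∷ w) = refl
mulS-involutive (suc (suc i)) []          = refl
mulS-involutive (suc (suc i)) (x ∷ w)     = cong (x ∷_) (mulS-involutive (suc i) w)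

All-mulS : ∀ {P : ℤ → Set} i w → i < length w → All P w → All P (mulS i w)
All-mulS zero          w           i<n         pw                = pw
All-mulS (suc zero)    (x ∷ [])    (s≤s ())    pw
All-mulS (suc zero)    (x ∷ y ∷ w) i<n         (px ∷ py ∷ pw)    = py ∷ px ∷ pw
All-mulS (suc (suc i)) (x ∷ w)     (s≤s i<n)   (px ∷ pw)         = px ∷ All-mulS (suc i) w i<n pw

Nonzero-neg : ∀ {x} → Nonzero x → Nonzero (- x)
Nonzero-neg (nz⁺ a) = nz⁻ a
Nonzero-neg (nz⁻ a) = nz⁺ a

All-Nonzero-mulS : ∀ i w → All Nonzero w → All Nonzero (mulS i w)
All-Nonzero-mulS zero          w           nw              = nw
All-Nonzero-mulS (suc zero)    []          nw              = nw
All-Nonzero-mulS (suc zero)    (x ∷ [])    (nx ∷ [])       = Nonzero-neg nx ∷ []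
All-Nonzero-mulS (suc zero)    (x ∷ y ∷ w) (nx ∷ ny ∷ nw)  = ny ∷ nx ∷ nw
All-Nonzero-mulS (suc (suc i)) []          nw              = nw
All-Nonzero-mulS (suc (suc i)) (x ∷ w)     (nx ∷ nw)       = nx ∷ All-Nonzero-mulS (suc i) w nw

private
  swapAt≡mulS : ∀ i w → swapAt i w ≡ mulS (suc i) w ⊎ length w ≤ suc i
  swapAt≡mulS zero    []          = inj₂ z≤n
  swapAt≡mulS zero    (x ∷ [])    = inj₂ ≤-refl
  swapAt≡mulS zero    (x ∷ y ∷ w) = inj₁ refl
  swapAt≡mulS (suc i) []          = inj₁ refl
  swapAt≡mulS (suc i) (x ∷ w) with swapAt≡mulS i w
  ... | inj₁ e = inj₁ (cong (x ∷_) e)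
  ... | inj₂ p = inj₂ (s≤s p)

  negLast≡mulS : ∀ x w → negLast (x ∷ w) ≡ mulS (length (x ∷ w)) (x ∷ w)
  negLast≡mulS x []      = refl
  negLast≡mulS x (y ∷ w) = cong (x ∷_) (negLast≡mulS y w)

rmul≡mulS : ∀ {n i} w → length w ≡ n → 1 ≤ i → i ≤ n → rmul n i w ≡ mulS i w
rmul≡mulS {n} {suc i} w len≡n _ i≤n with suc i <ᵇ n in i<ᵇn
rmul≡mulS {n} {suc i} w        len≡n _ i≤n | true with swapAt≡mulS i w
... | inj₁ e   = e
... | inj₂ n≤i = contradiction (subst (_≤ suc i) len≡n n≤i) (<⇒≱ (<ᵇ≡true⇒< i<ᵇn))
rmul≡mulS {n} {suc i} []       refl  _ ()  | false
rmul≡mulS {n} {suc i} (x ∷ w)  len≡n _ i≤n | false =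
  trans (negLast≡mulS x w) (cong (λ j → mulS j (x ∷ w)) (trans len≡n (≤-antisym (<ᵇ≡false⇒≥ i<ᵇn) i≤n)))

-- The Coxeter length of B_n

bit : Bool → ℕ
bit b = if b then 1 else 0

-- crossing x y = [−y ≺ x], spelled out so that its symmetry is evident.
crossing : ℤ → ℤ → ℕ
crossing (+ a)    (+ b)    = 0
crossing (+ a)    -[1+ b ] = bit (suc b <ᵇ a)
crossing -[1+ a ] (+ b)    = bit (suc a <ᵇ b)
crossing -[1+ a ] -[1+ b ] = 1

crossing-sym : ∀ x y → crossing x y ≡ crossing y x
crossing-sym (+ a)    (+ b)    = refl
crossing-sym (+ a)    -[1+ b ] = refl
crossing-sym -[1+ a ] (+ b)    = refl
crossing-sym -[1+ a ] -[1+ b ] = refl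

pairLength : ℤ → ℤ → ℕ
pairLength x y = bit (y ≺ᵇ x) + crossing x y

pairLengths : ℤ → List ℤ → ℕ
pairLengths x []      = 0
pairLengths x (y ∷ w) = pairLength x y + pairLengths x w

-- ℓ w = Σ_{i<j} ([w_j ≺ w_i] + [−w_j ≺ w_i]) + #{i | w_i < 0}.
ℓ : List ℤ → ℕ
ℓ []      = 0
ℓ (x ∷ w) = pairLengths x w + bit (not (isNonNeg x)) + ℓ w

pairLength-neg : ∀ x y → pairLength x (- y) ≡ pairLength x y
pairLength-neg x        (+ zero)    = refl
pairLength-neg (+ a)    (+ suc b)   = sym (+-identityʳ _)
pairLength-neg -[1+ a ] (+ suc b)   = +-comm (bit (a <ᵇ b)) 1
pairLength-neg (+ a)    -[1+ b ]    = +-identityʳ _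
pairLength-neg -[1+ a ] -[1+ b ]    = +-comm 1 (bit (a <ᵇ b))

pairLengths-mulS : ∀ x i w → pairLengths x (mulS i w) ≡ pairLengths x w
pairLengths-mulS x zero          w           = refl
pairLengths-mulS x (suc zero)    []          = refl
pairLengths-mulS x (suc zero)    (y ∷ [])    = cong (_+ 0) (pairLength-neg x y)
pairLengths-mulS x (suc zero)    (y ∷ z ∷ w) = x+[y+z]≡y+[x+z] (pairLength x z) (pairLength x y) (pairLengths x w)
  where
  x+[y+z]≡y+[x+z] : ∀ a b c → a + (b + c) ≡ b + (a + c)
  x+[y+z]≡y+[x+z] = solve-∀
pairLengths-mulS x (suc (suc i)) []          = refl
pairLengths-mulS x (suc (suc i)) (y ∷ w)     = cong (_+_ (pairLength x y)) (pairLengths-mulS x (suc i) w)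

≺ᵇ-asym : ∀ x y → (x ≺ᵇ y) ≡ true → (y ≺ᵇ x) ≡ false
≺ᵇ-asym (+ a)    (+ b)    e = ≥⇒<ᵇ≡false {b} (<⇒≤ (<ᵇ≡true⇒< {a} e))
≺ᵇ-asym (+ a)    -[1+ b ] e = refl
≺ᵇ-asym -[1+ a ] -[1+ b ] e = ≥⇒<ᵇ≡false {a} (<⇒≤ (<ᵇ≡true⇒< {b} e))

ℓ-swap : ∀ x y w → ℓ (y ∷ x ∷ w) + bit (y ≺ᵇ x) ≡ ℓ (x ∷ y ∷ w) + bit (x ≺ᵇ y)
ℓ-swap x y w rewrite crossing-sym y x =
  shuffle (bit (x ≺ᵇ y)) (bit (y ≺ᵇ x)) (crossing x y) (pairLengths y w) (bit (not (isNonNeg y)))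
          (pairLengths x w) (bit (not (isNonNeg x))) (ℓ w)
  where
  shuffle : ∀ a b p cy ny cx nx l → a + p + cy + ny + (cx + nx + l) + b ≡ b + p + cx + nx + (cy + ny + l) + a
  shuffle = solve-∀

ℓ-ascent : ∀ i w → All Nonzero w → ascentᵇ i w ≡ true → ℓ (mulS i w) ≡ suc (ℓ w)
ℓ-ascent (suc zero)    (.(+ suc a) ∷ []) (nz⁺ a ∷ []) asc = refl
ℓ-ascent (suc zero)    (x ∷ y ∷ w)       _            asc with ℓ-swap x y w
... | swap rewrite asc | ≺ᵇ-asym x y asc = trans (sym (+-identityʳ _)) (trans swap (+-comm _ 1))
ℓ-ascent (suc (suc i)) (x ∷ w)           (_ ∷ nw)     asc
  rewrite pairLengths-mulS x (suc i) w | ℓ-ascent (suc i) w nw asc = +-suc _ (ℓ w)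

ℓ-nonAscent : ∀ i w → ascentᵇ i w ≡ false → ℓ (mulS i w) ≤ ℓ w
ℓ-nonAscent zero          w                 _ = ≤-refl
ℓ-nonAscent (suc zero)    []                _ = ≤-refl
ℓ-nonAscent (suc zero)    (-[1+ a ] ∷ [])   _ = z≤n
ℓ-nonAscent (suc zero)    (x ∷ y ∷ w)       e = begin
  ℓ (y ∷ x ∷ w)                     ≤⟨ m≤m+n (ℓ (y ∷ x ∷ w)) (bit (y ≺ᵇ x)) ⟩
  ℓ (y ∷ x ∷ w) + bit (y ≺ᵇ x)      ≡⟨ ℓ-swap x y w ⟩
  ℓ (x ∷ y ∷ w) + bit (x ≺ᵇ y)      ≡⟨ cong (λ b → ℓ (x ∷ y ∷ w) + bit b) e ⟩
  ℓ (x ∷ y ∷ w) + 0                 ≡⟨ +-identityʳ _ ⟩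
  ℓ (x ∷ y ∷ w)                     ∎
  where open ≤-Reasoning
ℓ-nonAscent (suc (suc i)) []                _ = ≤-refl
ℓ-nonAscent (suc (suc i)) (x ∷ w)           e rewrite pairLengths-mulS x (suc i) w =
  +-monoʳ-≤ (pairLengths x w + bit (not (isNonNeg x))) (ℓ-nonAscent (suc i) w e)

ℓ-mulS-≤ : ∀ i w → All Nonzero w → ℓ (mulS i w) ≤ suc (ℓ w)
ℓ-mulS-≤ i w nw with ascentᵇ i w in e
... | true  = ≤-reflexive (ℓ-ascent i w nw e)
... | false = m≤n⇒m≤1+n (ℓ-nonAscent i w e)

ℓ-descent : ∀ i w → descentᵇ i w ≡ true → suc (ℓ (mulS i w)) ≡ ℓ w
ℓ-descent (suc zero)    (-[1+ a ] ∷ []) d = refl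
ℓ-descent (suc zero)    (x ∷ y ∷ w)     d with ℓ-swap x y w
... | swap rewrite d | ≺ᵇ-asym y x d = trans (+-comm 1 _) (trans swap (+-identityʳ _))
ℓ-descent (suc (suc i)) (x ∷ w)         d rewrite pairLengths-mulS x (suc i) w =
  trans (sym (+-suc _ _)) (cong (_+_ (pairLengths x w + bit (not (isNonNeg x)))) (ℓ-descent (suc i) w d))

ℓ-sorted : ∀ ws → Linked _≤_ ws → ℓ (map +_ ws) ≡ 0
ℓ-sorted []           _        = refl
ℓ-sorted (a ∷ [])     _        = refl
ℓ-sorted (a ∷ b ∷ ws) (a≤b ∷ l) =
  trans (cong (λ m → m + 0 + ℓ (map +_ (b ∷ ws))) (pairLengths-≥ (b ∷ ws) (Linked⇒All ≤-trans a≤b l)))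
        (ℓ-sorted (b ∷ ws) l)
  where
  pairLengths-≥ : ∀ vs → All (a ≤_) vs → pairLengths (+ a) (map +_ vs) ≡ 0
  pairLengths-≥ []       []           = refl
  pairLengths-≥ (v ∷ vs) (a≤v ∷ a≤vs) rewrite ≥⇒<ᵇ≡false {v} a≤v = pairLengths-≥ vs a≤vs

Descent : List ℤ → Set
Descent w = Σ ℕ λ i → 1 ≤ i × i ≤ length w × descentᵇ i w ≡ true

descent? : ∀ w → Descent w ⊎ (∀ i → descentᵇ i w ≡ false)
descent? []          = inj₂ λ { zero → refl ; (suc zero) → refl ; (suc (suc i)) → refl }
descent? (x ∷ []) with isNonNeg x in e
... | false = inj₁ (1 , ≤-refl , ≤-refl , cong not e)
... | true  = inj₂ λ { zero → refl ; (suc zero) → cong not e ; (suc (suc zero)) → refl ; (suc (suc (suc i))) → refl }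
descent? (x ∷ y ∷ w) with y ≺ᵇ x in e | descent? (y ∷ w)
... | true  | _                          = inj₁ (1 , ≤-refl , s≤s z≤n , e)
... | false | inj₁ (suc i , _ , i≤ , d) = inj₁ (suc (suc i) , s≤s z≤n , s≤s i≤ , d)
... | false | inj₂ none                  = inj₂ λ { zero → refl ; (suc zero) → e ; (suc (suc i)) → none (suc i) }

descentFree⇒sorted : ∀ w → (∀ i → descentᵇ i w ≡ false) → Σ (List ℕ) λ ws → w ≡ map +_ ws × Linked _≤_ ws
descentFree⇒sorted []               none = [] , refl , []
descentFree⇒sorted (+ a ∷ [])        none = a ∷ [] , refl , [-]
descentFree⇒sorted (-[1+ a ] ∷ [])   none with () ← none 1
descentFree⇒sorted (x ∷ y ∷ w)      none
  with descentFree⇒sorted (y ∷ w) (λ { zero → refl ; (suc i) → none (suc (suc i)) })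
... | b ∷ ws , refl , sorted with x | none 1
... | + a      | b≮a = a ∷ b ∷ ws , refl , <ᵇ≡false⇒≥ b≮a ∷ sorted
... | -[1+ a ] | ()

IsSignedPerm : ℕ → List ℤ → Set
IsSignedPerm n w = map ∣_∣ w ↭ map suc (upTo n)

IsSignedPerm-mulS : ∀ {n} i w → IsSignedPerm n w → IsSignedPerm n (mulS i w)
IsSignedPerm-mulS i w σ = ↭-trans (∣∣-mulS i w) σ
  where
  ∣∣-mulS : ∀ i w → map ∣_∣ (mulS i w) ↭ map ∣_∣ w
  ∣∣-mulS zero          w           = ↭-refl
  ∣∣-mulS (suc zero)    []          = ↭-refl
  ∣∣-mulS (suc zero)    (x ∷ [])    = ↭-reflexive (cong (_∷ []) (∣-i∣≡∣i∣ x))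
  ∣∣-mulS (suc zero)    (x ∷ y ∷ w) = ↭-swap ∣ y ∣ ∣ x ∣ ↭-refl
  ∣∣-mulS (suc (suc i)) []          = ↭-refl
  ∣∣-mulS (suc (suc i)) (x ∷ w)     = ↭-prep ∣ x ∣ (∣∣-mulS (suc i) w)

IsSignedPerm⇒length : ∀ {n} w → IsSignedPerm n w → length w ≡ n
IsSignedPerm⇒length {n} w σ = begin
  length w                   ≡⟨ length-map ∣_∣ w ⟨
  length (map ∣_∣ w)         ≡⟨ ↭-length σ ⟩
  length (map suc (upTo n))  ≡⟨ length-map suc (upTo n) ⟩
  length (upTo n)            ≡⟨ length-upTo n ⟩
  n                          ∎
  where open ≡-Reasoning

IsSignedPerm⇒Nonzero : ∀ {n} w → IsSignedPerm n w → All Nonzero w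
IsSignedPerm⇒Nonzero w σ = All.tabulate nonzero
  where
  nonzero : ∀ {x} → x ∈ w → Nonzero x
  nonzero {x} x∈w with ∈-map⁻ suc (∈-resp-↭ σ (∈-map⁺ ∣_∣ x∈w))
  nonzero {+ zero}    _ | _ , _ , ()
  nonzero {+ suc a}   _ | _ = nz⁺ a
  nonzero { -[1+ a ]} _ | _ = nz⁻ a

private
  idW≡ : ∀ n → idW n ≡ map (λ a → + a) (map suc (upTo n))
  idW≡ n = map-∘ (upTo n)

  ∣∣-+ : ∀ ws → map ∣_∣ (map +_ ws) ≡ ws
  ∣∣-+ []       = refl
  ∣∣-+ (a ∷ ws) = cong (a ∷_) (∣∣-+ ws)

  upTo-sorted : ∀ n → Linked _≤_ (map suc (upTo n))
  upTo-sorted n = subst (Linked _≤_) (sym (map-applyUpTo (λ x → x) suc n)) (applyUpTo-sorted suc n (λ i → n≤1+n (suc i)))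
    where
    applyUpTo-sorted : ∀ (f : ℕ → ℕ) m → (∀ i → f i ≤ f (suc i)) → Linked _≤_ (applyUpTo f m)
    applyUpTo-sorted f zero          _    = []
    applyUpTo-sorted f (suc zero)    _    = [-]
    applyUpTo-sorted f (suc (suc m)) mono = mono 0 ∷ applyUpTo-sorted (f ∘ suc) (suc m) (mono ∘ suc)

IsSignedPerm-idW : ∀ n → IsSignedPerm n (idW n)
IsSignedPerm-idW n = ↭-reflexive (trans (cong (map ∣_∣) (idW≡ n)) (∣∣-+ (map suc (upTo n))))

ℓ-idW : ∀ n → ℓ (idW n) ≡ 0
ℓ-idW n = trans (cong ℓ (idW≡ n)) (ℓ-sorted (map suc (upTo n)) (upTo-sorted n))

descentFree⇒idW : ∀ {n} w → IsSignedPerm n w → (∀ i → descentᵇ i w ≡ false) → w ≡ idW n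
descentFree⇒idW {n} w σ none with descentFree⇒sorted w none
... | ws , refl , sorted = trans (cong (map (λ a → + a)) ws≡) (sym (idW≡ n))
  where
  ws≡ : ws ≡ map suc (upTo n)
  ws≡ = Pointwise-≡⇒≡ (↗↭↗⇒≋ ≤-totalOrder sorted (upTo-sorted n) (↭⇒↭ₛ (subst (_↭ _) (∣∣-+ ws) σ)))

-- Removing descents one at a time exhibits a word of length ℓ w.
reducedWord : ∀ {n} w → IsSignedPerm n w →
  Σ (List ℕ) λ u → ValidWord n u × length u ≡ ℓ w × evalW n u ≡ w
reducedWord {n} w σ = go (ℓ w) w refl σ
  where
  go : ∀ m w → ℓ w ≡ m → IsSignedPerm n w → Σ (List ℕ) λ u → ValidWord n u × length u ≡ m × evalW n u ≡ w
  go m w ℓw≡m σ with descent? w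
  go zero    w ℓw≡m σ | inj₁ (i , _ , _ , d) = contradiction (trans (ℓ-descent i w d) ℓw≡m) λ ()
  go (suc m) w ℓw≡m σ | inj₁ (i , 1≤i , i≤len , d)
    with u , valid , len , eval ← go m (mulS i w) (suc-injective (trans (ℓ-descent i w d) ℓw≡m)) (IsSignedPerm-mulS i w σ) =
    u ++ i ∷ [] , All.++⁺ valid ((1≤i , i≤n) ∷ []) ,
    trans (length-++ u) (trans (+-comm (length u) 1) (cong suc len)) ,
    (begin
      evalW n (u ++ i ∷ [])       ≡⟨ foldl-++ (λ x j → rmul n j x) (idW n) u (i ∷ []) ⟩
      rmul n i (evalW n u)        ≡⟨ cong (rmul n i) eval ⟩
      rmul n i (mulS i w)         ≡⟨ rmul≡mulS (mulS i w) (trans (length-mulS i w) (IsSignedPerm⇒length w σ)) 1≤i i≤n ⟩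
      mulS i (mulS i w)           ≡⟨ mulS-involutive i w ⟩
      w                           ∎)
    where
    open ≡-Reasoning
    i≤n = subst (i ≤_) (IsSignedPerm⇒length w σ) i≤len
  go m w ℓw≡m σ | inj₂ none with descentFree⇒idW w σ none
  go zero    w ℓw≡m σ | inj₂ none | w≡id = [] , [] , refl , sym w≡id
  go (suc m) w ℓw≡m σ | inj₂ none | w≡id =
    contradiction (trans (sym (trans (cong ℓ w≡id) (ℓ-idW n))) ℓw≡m) λ ()

ℓ-·[]-≤ : ∀ {n} u w → IsSignedPerm n w → ValidWord n u → ℓ (w ·[ n ] u) ≤ ℓ w + length u
ℓ-·[]-≤         []      w σ []                 = ≤-reflexive (sym (+-identityʳ _))
ℓ-·[]-≤ {n} (i ∷ u) w σ ((1≤i , i≤n) ∷ valid)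
  rewrite rmul≡mulS w (IsSignedPerm⇒length w σ) 1≤i i≤n = begin
  ℓ (mulS i w ·[ n ] u)        ≤⟨ ℓ-·[]-≤ u (mulS i w) (IsSignedPerm-mulS i w σ) valid ⟩
  ℓ (mulS i w) + length u      ≤⟨ +-monoˡ-≤ (length u) (ℓ-mulS-≤ i w (IsSignedPerm⇒Nonzero w σ)) ⟩
  suc (ℓ w) + length u         ≡⟨ +-suc (ℓ w) (length u) ⟨
  ℓ w + suc (length u)         ∎
  where open ≤-Reasoning

Len-ℓ : ∀ {n} w → IsSignedPerm n w → Len n w (ℓ w)
Len-ℓ {n} w σ = reducedWord w σ , minimal
  where
  minimal : ∀ u → ValidWord n u → evalW n u ≡ w → ℓ w ≤ length u
  minimal u valid refl = subst (λ m → ℓ (evalW n u) ≤ m + length u) (ℓ-idW n)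
                               (ℓ-·[]-≤ u (idW n) (IsSignedPerm-idW n) valid)

Len-unique : ∀ {n w k k′} → Len n w k → Len n w k′ → k ≡ k′
Len-unique ((u , valid , len , eval) , min) ((u′ , valid′ , len′ , eval′) , min′) =
  ≤-antisym (subst (_ ≤_) len′ (min u′ valid′ eval′)) (subst (_ ≤_) len (min′ u valid eval))

Bruhat<⇒Len< : ∀ {n x y} → Bruhat< n x y → Σ ℕ λ k → Σ ℕ λ m → Len n x k × Len n y m × k < m
Bruhat<⇒Len< [ (_ , _ , _ , step) ] = step
Bruhat<⇒Len< ((_ , _ , _ , k , m , lenx , leny , k<m) ∷ rest) with Bruhat<⇒Len< rest
... | m′ , m″ , leny′ , lenz , m′<m″ =
  k , m″ , lenx , lenz , <-trans k<m (subst (_< m″) (sym (Len-unique leny leny′)) m′<m″)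

ascent⇒Bruhat< : ∀ {n} i v → IsSignedPerm n v → 1 ≤ i → i ≤ n → ascentᵇ i v ≡ true → Bruhat< n v (rmul n i v)
ascent⇒Bruhat< {n} i v σ 1≤i i≤n asc rewrite rmul≡mulS v (IsSignedPerm⇒length v σ) 1≤i i≤n =
  [ (i ∷ [] , ([] , i , [] , (1≤i , i≤n) , refl) , sym (rmul≡mulS v (IsSignedPerm⇒length v σ) 1≤i i≤n) ,
     ℓ v , ℓ (mulS i v) , Len-ℓ v σ , Len-ℓ (mulS i v) (IsSignedPerm-mulS i v σ) ,
     ≤-reflexive (sym (ℓ-ascent i v (IsSignedPerm⇒Nonzero v σ) asc))) ]

Bruhat<⇒ascent : ∀ {n} i v → IsSignedPerm n v → 1 ≤ i → i ≤ n → Bruhat< n v (rmul n i v) → ascentᵇ i v ≡ true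
Bruhat<⇒ascent {n} i v σ 1≤i i≤n v<vs with Bruhat<⇒Len< v<vs | ascentᵇ i v in asc
... | _                              | true  = refl
... | k , m , lenv , lenvs , k<m | false rewrite rmul≡mulS v (IsSignedPerm⇒length v σ) 1≤i i≤n =
  contradiction (ℓ-nonAscent i v asc)
    (<⇒≱ (subst₂ _<_ (Len-unique lenv (Len-ℓ v σ)) (Len-unique lenvs (Len-ℓ (mulS i v) (IsSignedPerm-mulS i v σ))) k<m))

-- Counting Γ-diagrams

gammaᵇ : List (ℕ × Sym) → List ℤ → Bool
gammaᵇ []            v = true
gammaᵇ ((i , O) ∷ l) v = ascentᵇ i v ∧ gammaᵇ l (mulS i v)
gammaᵇ ((i , P) ∷ l) v = ascentᵇ i v ∧ gammaᵇ l v

GammaFrom⇒gammaᵇ : ∀ {n} is ds v → IsSignedPerm n v → ValidWord n is →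
  GammaFrom n v (zip is ds) → gammaᵇ (zip is ds) v ≡ true
GammaFrom⇒gammaᵇ []       ds       v σ valid                  γ          = refl
GammaFrom⇒gammaᵇ (i ∷ is) []       v σ valid                  γ          = refl
GammaFrom⇒gammaᵇ (i ∷ is) (O ∷ ds) v σ ((1≤i , i≤n) ∷ valid) (v<vs , γ)
  rewrite Bruhat<⇒ascent i v σ 1≤i i≤n v<vs | rmul≡mulS v (IsSignedPerm⇒length v σ) 1≤i i≤n =
  GammaFrom⇒gammaᵇ is ds (mulS i v) (IsSignedPerm-mulS i v σ) valid γ
GammaFrom⇒gammaᵇ (i ∷ is) (P ∷ ds) v σ ((1≤i , i≤n) ∷ valid) (v<vs , γ)
  rewrite Bruhat<⇒ascent i v σ 1≤i i≤n v<vs =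
  GammaFrom⇒gammaᵇ is ds v σ valid γ

gammaᵇ⇒GammaFrom : ∀ {n} is ds v → IsSignedPerm n v → ValidWord n is →
  gammaᵇ (zip is ds) v ≡ true → GammaFrom n v (zip is ds)
gammaᵇ⇒GammaFrom []       ds       v σ valid                 γ = _
gammaᵇ⇒GammaFrom (i ∷ is) []       v σ valid                 γ = _
gammaᵇ⇒GammaFrom (i ∷ is) (O ∷ ds) v σ ((1≤i , i≤n) ∷ valid) γ with ascentᵇ i v in asc
... | true rewrite rmul≡mulS v (IsSignedPerm⇒length v σ) 1≤i i≤n =
  subst (λ w → Bruhat< _ v w) (rmul≡mulS v (IsSignedPerm⇒length v σ) 1≤i i≤n) (ascent⇒Bruhat< i v σ 1≤i i≤n asc) ,
  gammaᵇ⇒GammaFrom is ds (mulS i v) (IsSignedPerm-mulS i v σ) valid γ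
gammaᵇ⇒GammaFrom (i ∷ is) (P ∷ ds) v σ ((1≤i , i≤n) ∷ valid) γ with ascentᵇ i v in asc
... | true = ascent⇒Bruhat< i v σ 1≤i i≤n asc , gammaᵇ⇒GammaFrom is ds v σ valid γ

-- gammaSum l v K sums q^{#+} · K(v′) over the fillings of the word l by
-- {0,+} satisfying the Γ-condition from v, where v′ is the final v_(k).
gammaSum : List ℕ → List ℤ → (List ℤ → Poly) → Poly
gammaSum []      v K = K v
gammaSum (i ∷ l) v K = if ascentᵇ i v then gammaSum l (mulS i v) K ⊕ q· gammaSum l v K else 0ₚ

allVecs : ∀ n → List (Vec Sym n)
allVecs zero    = Vec.[] ∷ []
allVecs (suc n) = map (O Vec.∷_) (allVecs n) ++ map (P Vec.∷_) (allVecs n)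

allVecs-complete : ∀ n (D : Vec Sym n) → D ∈ allVecs n
allVecs-complete zero    Vec.[]       = here refl
allVecs-complete (suc n) (O Vec.∷ D) = ∈-++⁺ˡ (∈-map⁺ (O Vec.∷_) (allVecs-complete n D))
allVecs-complete (suc n) (P Vec.∷ D) = ∈-++⁺ʳ (map (O Vec.∷_) (allVecs n)) (∈-map⁺ (P Vec.∷_) (allVecs-complete n D))

allVecs-unique : ∀ n → Unique (allVecs n)
allVecs-unique zero    = [] ∷ []
allVecs-unique (suc n) = Unique.++⁺ (Unique.map⁺ ∷-injectiveʳ (allVecs-unique n)) (Unique.map⁺ ∷-injectiveʳ (allVecs-unique n)) disjoint
  where
  disjoint : ∀ {D} → D ∈ map (O Vec.∷_) (allVecs n) × D ∈ map (P Vec.∷_) (allVecs n) → ⊥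
  disjoint (D∈O , D∈P) with ∈-map⁻ (O Vec.∷_) D∈O | ∈-map⁻ (P Vec.∷_) D∈P
  ... | _ , _ , refl | _ , _ , ()

private
  length-filterᵇ-map : ∀ {A B : Set} (p : B → Bool) (f : A → B) xs →
    length (filterᵇ p (map f xs)) ≡ length (filterᵇ (p ∘ f) xs)
  length-filterᵇ-map p f []       = refl
  length-filterᵇ-map p f (x ∷ xs) with p (f x)
  ... | true  = cong suc (length-filterᵇ-map p f xs)
  ... | false = length-filterᵇ-map p f xs

  length-filterᵇ-none : ∀ {A : Set} (p : A → Bool) → (∀ x → p x ≡ false) → ∀ xs → length (filterᵇ p xs) ≡ 0
  length-filterᵇ-none p none xs = cong length (filter-none (T? ∘ p) (All.universal (λ x → subst T (none x) ∘ id) xs))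

isCounted : (L : List (ℕ × ℕ)) → List ℤ → ℕ → Vec Sym (length L) → Bool
isCounted L v k D = gammaᵇ (zip (map label L) (Vec.toList D)) v ∧ (plusCount (Vec.toList D) ≡ᵇ k)

count≡gammaSum : ∀ L v k → length (filterᵇ (isCounted L v k) (allVecs (length L))) ≡ gammaSum (map label L) v (λ _ → 1ₚ) k
count≡gammaSum []      v zero    = refl
count≡gammaSum []      v (suc k) = refl
count≡gammaSum (box ∷ L) v k = begin
  length (filterᵇ (isCounted (box ∷ L) v k) (map (O Vec.∷_) A ++ map (P Vec.∷_) A))
    ≡⟨ cong length (filter-++ (T? ∘ isCounted (box ∷ L) v k) (map (O Vec.∷_) A) (map (P Vec.∷_) A)) ⟩
  length (filterᵇ (isCounted (box ∷ L) v k) (map (O Vec.∷_) A) ++ filterᵇ (isCounted (box ∷ L) v k) (map (P Vec.∷_) A))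
    ≡⟨ length-++ (filterᵇ (isCounted (box ∷ L) v k) (map (O Vec.∷_) A)) ⟩
  length (filterᵇ (isCounted (box ∷ L) v k) (map (O Vec.∷_) A)) + length (filterᵇ (isCounted (box ∷ L) v k) (map (P Vec.∷_) A))
    ≡⟨ cong₂ _+_ (length-filterᵇ-map (isCounted (box ∷ L) v k) (O Vec.∷_) A)
                 (length-filterᵇ-map (isCounted (box ∷ L) v k) (P Vec.∷_) A) ⟩
  countO (ascentᵇ i v) k + countP (ascentᵇ i v) k
    ≡⟨ split (ascentᵇ i v) k ⟩
  gammaSum (map label (box ∷ L)) v (λ _ → 1ₚ) k
    ∎
  where
  open ≡-Reasoning
  i = label box
  A = allVecs (length L)
  countO countP : Bool → ℕ → ℕ
  countO b k = length (filterᵇ (λ D → (b ∧ gammaᵇ (zip (map label L) (Vec.toList D)) (mulS i v)) ∧ (plusCount (Vec.toList D) ≡ᵇ k)) A)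
  countP b k = length (filterᵇ (λ D → (b ∧ gammaᵇ (zip (map label L) (Vec.toList D)) v) ∧ (suc (plusCount (Vec.toList D)) ≡ᵇ k)) A)
  split : ∀ b k → countO b k + countP b k ≡ (if b then gammaSum (map label L) (mulS i v) (λ _ → 1ₚ) ⊕ q· gammaSum (map label L) v (λ _ → 1ₚ) else 0ₚ) k
  split false k       = cong₂ _+_ (length-filterᵇ-none _ (λ _ → refl) A) (length-filterᵇ-none _ (λ _ → refl) A)
  split true  zero    = cong₂ _+_ (count≡gammaSum L (mulS i v) zero)
                                  (length-filterᵇ-none _ (λ D → ∧-zeroʳ (gammaᵇ (zip (map label L) (Vec.toList D)) v)) A)
  split true  (suc k) = cong₂ _+_ (count≡gammaSum L (mulS i v) (suc k)) (count≡gammaSum L v k)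

HasCount-unique : {A : Set} {Pr : A → Set} {c : ℕ} → HasCount Pr c →
  (l : List A) → Unique l → (∀ x → (x ∈ l) ⇔ Pr x) → c ≡ length l
HasCount-unique (l′ , unique′ , mem′ , len′) l unique mem =
  trans (sym len′) (↭-length (∼bag⇒↭ (unique∧set⇒bag unique′ unique λ {x} →
    mk⇔ (Equivalence.from (mem x) ∘ Equivalence.to (mem′ x)) (Equivalence.from (mem′ x) ∘ Equivalence.to (mem x)))))

topRow : ℕ → List ℕ
topRow k = map suc (downFrom k)

readingWord : ℕ → List ℕ
readingWord zero    = []
readingWord (suc m) = topRow (suc m) ++ map suc (readingWord m)

ValidWord-readingWord : ∀ m → ValidWord m (readingWord m)
ValidWord-readingWord zero    = []
ValidWord-readingWord (suc m) =
  All.++⁺ (topRow-valid (suc m)) (All.map⁺ (All.map (λ (1≤i , i≤m) → s≤s z≤n , s≤s i≤m) (ValidWord-readingWord m)))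
  where
  topRow-valid : ∀ k → ValidWord k (topRow k)
  topRow-valid zero    = []
  topRow-valid (suc k) = (s≤s z≤n , ≤-refl) ∷ All.map (λ (1≤i , i≤k) → 1≤i , m≤n⇒m≤1+n i≤k) (topRow-valid k)

labels-revLinExt : ∀ n → map label (revLinExt n) ≡ readingWord n
labels-revLinExt n = begin
  map label (revLinExt n)               ≡⟨ map-concatMap label (row n) (map suc (upTo n)) ⟩
  concatMap (map label ∘ row n) (map suc (upTo n)) ≡⟨ concatMap-cong (λ r → sym (map-∘ {g = label} (map suc (downFrom (n ∸ r + 1))))) (map suc (upTo n)) ⟩
  concatMap (rowLabels n) (map suc (upTo n))      ≡⟨ rowsLabels n ⟩
  readingWord n                                   ∎
  where
  open ≡-Reasoning
  row : ℕ → ℕ → List (ℕ × ℕ)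
  row n r = map (λ c → (r , c)) (map suc (downFrom (n ∸ r + 1)))
  rowLabels : ℕ → ℕ → List ℕ
  rowLabels n r = map (λ c → r + c ∸ 1) (map suc (downFrom (n ∸ r + 1)))
  rowsLabels : ∀ n → concatMap (rowLabels n) (map suc (upTo n)) ≡ readingWord n
  rowsLabels zero    = refl
  rowsLabels (suc m) = cong₂ _++_ first rest
    where
    first : rowLabels (suc m) 1 ≡ topRow (suc m)
    first = trans (map-id (map suc (downFrom (m + 1)))) (cong (λ k → map suc (downFrom k)) (+-comm m 1))
    rest : concatMap (rowLabels (suc m)) (map suc (applyUpTo suc m)) ≡ map suc (readingWord m)
    rest = begin
      concatMap (rowLabels (suc m)) (map suc (applyUpTo suc m))   ≡⟨ concatMap-map (rowLabels (suc m)) suc (applyUpTo suc m) ⟩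
      concatMap (rowLabels (suc m) ∘ suc) (applyUpTo suc m)       ≡⟨ cong (concatMap (rowLabels (suc m) ∘ suc)) (map-applyUpTo (λ x → x) suc m) ⟨
      concatMap (rowLabels (suc m) ∘ suc) (map suc (upTo m))      ≡⟨ concatMap-map (rowLabels (suc m) ∘ suc) suc (upTo m) ⟩
      concatMap (rowLabels (suc m) ∘ suc ∘ suc) (upTo m)           ≡⟨ concatMap-cong (λ j → map-∘ {g = suc} (map suc (downFrom (m ∸ suc j + 1)))) (upTo m) ⟩
      concatMap (map suc ∘ rowLabels m ∘ suc) (upTo m)            ≡⟨ map-concatMap suc (rowLabels m ∘ suc) (upTo m) ⟨
      map suc (concatMap (rowLabels m ∘ suc) (upTo m))            ≡⟨ cong (map suc) (concatMap-map (rowLabels m) suc (upTo m)) ⟨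
      map suc (concatMap (rowLabels m) (map suc (upTo m)))        ≡⟨ cong (map suc) (rowsLabels m) ⟩
      map suc (readingWord m)                                     ∎

mulS-++ : ∀ i u ys → i < length u → mulS i (u ++ ys) ≡ mulS i u ++ ys
mulS-++ zero          u           ys _          = refl
mulS-++ (suc zero)    (x ∷ [])    ys (s≤s ())
mulS-++ (suc zero)    (x ∷ y ∷ u) ys _          = refl
mulS-++ (suc (suc i)) (x ∷ u)     ys (s≤s i<n)  = cong (x ∷_) (mulS-++ (suc i) u ys i<n)

ascentᵇ-++ : ∀ i u ys → i < length u → ascentᵇ i (u ++ ys) ≡ ascentᵇ i u
ascentᵇ-++ zero          u           ys _          = refl
ascentᵇ-++ (suc zero)    (x ∷ [])    ys (s≤s ())
ascentᵇ-++ (suc zero)    (x ∷ y ∷ u) ys _          = refl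
ascentᵇ-++ (suc (suc i)) (x ∷ u)     ys (s≤s i<n)  = ascentᵇ-++ (suc i) u ys i<n

mulS-last : ∀ v c → mulS (suc (length v)) (v ++ c ∷ []) ≡ v ++ - c ∷ []
mulS-last []          c = refl
mulS-last (x ∷ [])    c = refl
mulS-last (x ∷ y ∷ v) c = cong (x ∷_) (mulS-last (y ∷ v) c)

ascentᵇ-last : ∀ v c → ascentᵇ (suc (length v)) (v ++ c ∷ []) ≡ isNonNeg c
ascentᵇ-last []          c = refl
ascentᵇ-last (x ∷ [])    c = refl
ascentᵇ-last (x ∷ y ∷ v) c = ascentᵇ-last (y ∷ v) c

mulS-lastTwo : ∀ v y c → mulS (suc (length v)) (v ++ y ∷ c ∷ []) ≡ v ++ c ∷ y ∷ []
mulS-lastTwo []          y c = refl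
mulS-lastTwo (x ∷ [])    y c = refl
mulS-lastTwo (x ∷ x′ ∷ v) y c = cong (x ∷_) (mulS-lastTwo (x′ ∷ v) y c)

ascentᵇ-lastTwo : ∀ v y c → ascentᵇ (suc (length v)) (v ++ y ∷ c ∷ []) ≡ (y ≺ᵇ c)
ascentᵇ-lastTwo []           y c = refl
ascentᵇ-lastTwo (x ∷ [])     y c = refl
ascentᵇ-lastTwo (x ∷ x′ ∷ v) y c = ascentᵇ-lastTwo (x′ ∷ v) y c

if-cong : ∀ b {p p′ r r′ : Poly} → p ≈P p′ → r ≈P r′ → (if b then p else r) ≈P (if b then p′ else r′)
if-cong true  e f = e
if-cong false e f = f

⊕-q·-zero : ∀ {p r} → p ≈P 0ₚ → r ≈P 0ₚ → (p ⊕ q· r) ≈P 0ₚ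
⊕-q·-zero ep er = ≈P-trans (⊕-cong ep (≈P-trans (q·-cong er) q·-zero)) (⊕-identityʳ 0ₚ)

Invariant : (List ℤ → Set) → List ℕ → Set
Invariant I l = All (λ i → ∀ u → I u → I (mulS i u)) l

gammaSum-congᴵ : ∀ (I : List ℤ → Set) l → Invariant I l → ∀ v → I v →
  ∀ {K K′} → (∀ u → I u → K u ≈P K′ u) → gammaSum l v K ≈P gammaSum l v K′
gammaSum-congᴵ I []      []         v Iv e = e v Iv
gammaSum-congᴵ I (i ∷ l) (inv ∷ invs) v Iv e = if-cong (ascentᵇ i v)
  (⊕-cong (gammaSum-congᴵ I l invs (mulS i v) (inv v Iv) e) (q·-cong (gammaSum-congᴵ I l invs v Iv e))) ≈P-refl

gammaSum-zeroᴵ : ∀ (I : List ℤ → Set) l → Invariant I l → ∀ v → I v →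
  ∀ {K} → (∀ u → I u → K u ≈P 0ₚ) → gammaSum l v K ≈P 0ₚ
gammaSum-zeroᴵ I l invs v Iv e = ≈P-trans (gammaSum-congᴵ I l invs v Iv e) (gammaSum-zero l v)
  where
  gammaSum-zero : ∀ l v → gammaSum l v (λ _ → 0ₚ) ≈P 0ₚ
  gammaSum-zero []      v = ≈P-refl
  gammaSum-zero (i ∷ l) v with ascentᵇ i v
  ... | true  = ⊕-q·-zero (gammaSum-zero l (mulS i v)) (gammaSum-zero l v)
  ... | false = ≈P-refl

gammaSum-++ : ∀ l₁ l₂ v K → gammaSum (l₁ ++ l₂) v K ≈P gammaSum l₁ v (λ u → gammaSum l₂ u K)
gammaSum-++ []       l₂ v K = ≈P-refl
gammaSum-++ (i ∷ l₁) l₂ v K = if-cong (ascentᵇ i v)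
  (⊕-cong (gammaSum-++ l₁ l₂ (mulS i v) K) (q·-cong (gammaSum-++ l₁ l₂ v K))) ≈P-refl

gammaSum-map-suc : ∀ l x w K → All (1 ≤_) l → gammaSum (map suc l) (x ∷ w) K ≈P gammaSum l w (λ u → K (x ∷ u))
gammaSum-map-suc []          x w K []            = ≈P-refl
gammaSum-map-suc (suc i ∷ l) x w K (s≤s z≤n ∷ l≥1) = if-cong (ascentᵇ (suc i) w)
  (⊕-cong (gammaSum-map-suc l x (mulS (suc i) w) K l≥1) (q·-cong (gammaSum-map-suc l x w K l≥1))) ≈P-refl

gammaSum-∷ʳ : ∀ l u y K → All (_< length u) l → gammaSum l (u ++ y ∷ []) K ≈P gammaSum l u (λ u′ → K (u′ ++ y ∷ []))
gammaSum-∷ʳ []      u y K []           = ≈P-refl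
gammaSum-∷ʳ (i ∷ l) u y K (i<n ∷ l<n)
  rewrite ascentᵇ-++ i u (y ∷ []) i<n | mulS-++ i u (y ∷ []) i<n = if-cong (ascentᵇ i u)
  (⊕-cong (gammaSum-∷ʳ l (mulS i u) y K (All.map (λ j<n → subst (_ <_) (sym (length-mulS i u)) j<n) l<n))
          (q·-cong (gammaSum-∷ʳ l u y K l<n))) ≈P-refl

-- Left-to-right maxima

records : ℕ → List ℤ → ℕ
records t []             = 0
records t (+ a ∷ w)      = if t <ᵇ a then suc (records a w) else records t w
records t (-[1+ _ ] ∷ w) = records t w

runningMax : ℕ → List ℤ → ℕ
runningMax t []             = t
runningMax t (+ a ∷ w)      = if t <ᵇ a then runningMax a w else runningMax t w
runningMax t (-[1+ _ ] ∷ w) = runningMax t w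

hasNeg : List ℤ → Bool
hasNeg []             = false
hasNeg (+ _ ∷ w)      = hasNeg w
hasNeg (-[1+ _ ] ∷ w) = true

data Below (c : ℕ) : ℤ → Set where
  below : ∀ {a} → a < c → Below c (+ a)

Below-mono : ∀ {c c′} → c ≤ c′ → ∀ {x} → Below c x → Below c′ x
Below-mono c≤c′ (below a<c) = below (≤-trans a<c c≤c′)

records-++ : ∀ t v s → records t (v ++ s) ≡ records t v + records (runningMax t v) s
records-++ t []             s = refl
records-++ t (+ a ∷ v)      s with t <ᵇ a
... | true  = cong suc (records-++ a v s)
... | false = records-++ t v s
records-++ t (-[1+ _ ] ∷ v) s = records-++ t v s

runningMax-++ : ∀ t v s → runningMax t (v ++ s) ≡ runningMax (runningMax t v) s
runningMax-++ t []             s = refl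
runningMax-++ t (+ a ∷ v)      s with t <ᵇ a
... | true  = runningMax-++ a v s
... | false = runningMax-++ t v s
runningMax-++ t (-[1+ _ ] ∷ v) s = runningMax-++ t v s

runningMax-< : ∀ {c} t v → t < c → All (Below c) v → runningMax t v < c
runningMax-< t []        t<c []                = t<c
runningMax-< t (+ a ∷ v) t<c (below a<c ∷ v<c) with t <ᵇ a
... | true  = runningMax-< a v a<c v<c
... | false = runningMax-< t v t<c v<c

records-≡0 : ∀ c v → All (Below (suc c)) v → records c v ≡ 0
records-≡0 c []        []                      = refl
records-≡0 c (+ a ∷ v) (below (s≤s a≤c) ∷ v<c) rewrite ≥⇒<ᵇ≡false {c} a≤c = records-≡0 c v v<c

runningMax-≥ : ∀ t v → t ≤ runningMax t v
runningMax-≥ t []             = ≤-refl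
runningMax-≥ t (+ a ∷ v)      with t <ᵇ a in t<ᵇa
... | true  = ≤-trans (<⇒≤ (<ᵇ≡true⇒< t<ᵇa)) (runningMax-≥ a v)
... | false = runningMax-≥ t v
runningMax-≥ t (-[1+ _ ] ∷ v) = runningMax-≥ t v

Below-runningMax : ∀ t v → All Positive v → All (Below (suc (runningMax t v))) v
Below-runningMax t []              []           = []
Below-runningMax t (.(+ suc a) ∷ v) (pos a ∷ pv) with t <ᵇ suc a in t<ᵇa
... | true  = below (s≤s (runningMax-≥ (suc a) v)) ∷ Below-runningMax (suc a) v pv
... | false = below (s≤s (≤-trans (<ᵇ≡false⇒≥ t<ᵇa) (runningMax-≥ t v))) ∷ Below-runningMax t v pv

records-∷ʳ-record : ∀ v c → runningMax 0 v < c → records 0 (v ++ + c ∷ []) ≡ suc (records 0 v)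
records-∷ʳ-record v c max<c rewrite records-++ 0 v (+ c ∷ []) | <⇒<ᵇ≡true max<c =
  trans (+-suc (records 0 v) 0) (cong suc (+-identityʳ _))

records-∷ʳ-nonRecord : ∀ v c → c ≤ runningMax 0 v → records 0 (v ++ + c ∷ []) ≡ records 0 v
records-∷ʳ-nonRecord v c c≤max rewrite records-++ 0 v (+ c ∷ []) | ≥⇒<ᵇ≡false c≤max = +-identityʳ _

runningMax-∷ʳ : ∀ v a → runningMax 0 (v ++ + a ∷ []) ≡ (if runningMax 0 v <ᵇ a then a else runningMax 0 v)
runningMax-∷ʳ v a = runningMax-++ 0 v (+ a ∷ [])

records-≤-length : ∀ t v → records t v ≤ length v
records-≤-length t []             = z≤n
records-≤-length t (+ a ∷ v)      with t <ᵇ a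
... | true  = s≤s (records-≤-length a v)
... | false = m≤n⇒m≤1+n (records-≤-length t v)
records-≤-length t (-[1+ _ ] ∷ v) = m≤n⇒m≤1+n (records-≤-length t v)

hasNeg-positive : ∀ v → All Positive v → hasNeg v ≡ false
hasNeg-positive []                []           = refl
hasNeg-positive (.(+ suc a) ∷ v) (pos a ∷ pv) = hasNeg-positive v pv

hasNeg-middle : ∀ v a s → hasNeg (v ++ -[1+ a ] ∷ s) ≡ true
hasNeg-middle []             a s = refl
hasNeg-middle (+ _ ∷ v)      a s = hasNeg-middle v a s
hasNeg-middle (-[1+ _ ] ∷ v) a s = refl

hasNeg-∷ʳ-+ : ∀ v a → hasNeg (v ++ + a ∷ []) ≡ hasNeg v
hasNeg-∷ʳ-+ []             a = refl
hasNeg-∷ʳ-+ (+ _ ∷ v)      a = hasNeg-∷ʳ-+ v a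
hasNeg-∷ʳ-+ (-[1+ _ ] ∷ v) a = refl

idW-suc : ∀ m → idW (suc m) ≡ idW m ++ + suc m ∷ []
idW-suc m = trans (cong (map (λ i → + suc i)) (sym (applyUpTo-∷ʳ (λ x → x) m)))
                  (map-++ (λ i → + suc i) (upTo m) (m ∷ []))

idW-records : ∀ m → runningMax 0 (idW m) ≡ m × records 0 (idW m) ≡ m × All Positive (idW m)
idW-records zero    = refl , refl , []
idW-records (suc m) with max≡m , rec≡m , pv ← idW-records m =
  subst (λ w → runningMax 0 w ≡ suc m × records 0 w ≡ suc m × All Positive w) (sym (idW-suc m))
    ( trans (runningMax-∷ʳ (idW m) (suc m)) (cong (λ b → if b then suc m else runningMax 0 (idW m)) (<⇒<ᵇ≡true max<))
    , trans (records-∷ʳ-record (idW m) (suc m) max<) (cong suc rec≡m)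
    , All.++⁺ pv (pos m ∷ []))
  where
  max< : runningMax 0 (idW m) < suc m
  max< = s≤s (≤-reflexive max≡m)

-- Sweeping the last entry through the top row

Window : (ℤ → Set) → ℕ → List ℤ → Set
Window Q n u = length u ≡ n × All Q u

length-∷ʳ : ∀ {A : Set} (v : List A) x → length (v ++ x ∷ []) ≡ suc (length v)
length-∷ʳ []      x = refl
length-∷ʳ (y ∷ v) x = cong suc (length-∷ʳ v x)

private
  topRow-< : ∀ k → All (_< suc k) (topRow k)
  topRow-< zero    = []
  topRow-< (suc k) = ≤-refl ∷ All.map m≤n⇒m≤1+n (topRow-< k)

Window-invariant : ∀ (Q : ℤ → Set) k → Invariant (Window Q (suc k)) (topRow k)
Window-invariant Q k = All.map (λ {i} i<k u (len , qu) →
  trans (length-mulS i u) len , All-mulS i u (subst (i <_) (sym len) i<k) qu) (topRow-< k)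

Window-∷ʳ : ∀ {Q : ℤ → Set} v c → All Q v → Q c → Window Q (suc (length v)) (v ++ c ∷ [])
Window-∷ʳ v c qv qc = length-∷ʳ v c , All.∷ʳ⁺ qv qc

Window-⊤ : ∀ v c → Window (λ _ → ⊤) (suc (length v)) (v ++ c ∷ [])
Window-⊤ v c = Window-∷ʳ v c (All.universal (λ _ → tt) v) tt

private
  gammaSum-freezeLast : ∀ v x z K →
    gammaSum (topRow (length v)) (v ++ x ∷ z ∷ []) K ≈P gammaSum (topRow (length v)) (v ++ x ∷ []) (λ u → K (u ++ z ∷ []))
  gammaSum-freezeLast v x z K =
    subst (λ w → gammaSum (topRow (length v)) w K ≈P gammaSum (topRow (length v)) (v ++ x ∷ []) (λ u → K (u ++ z ∷ [])))
          (++-assoc v (x ∷ []) (z ∷ []))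
          (gammaSum-∷ʳ (topRow (length v)) (v ++ x ∷ []) z K
            (subst (λ n → All (_< n) (topRow (length v))) (sym (length-∷ʳ v x)) (topRow-< (length v))))

sweep-ascent : ∀ v y c K → (y ≺ᵇ c) ≡ true → gammaSum (topRow (suc (length v))) ((v ++ y ∷ []) ++ c ∷ []) K ≈P
  (gammaSum (topRow (length v)) (v ++ c ∷ []) (λ u → K (u ++ y ∷ []))
   ⊕ q· gammaSum (topRow (length v)) (v ++ y ∷ []) (λ u → K (u ++ c ∷ [])))
sweep-ascent v y c K y≺c rewrite ++-assoc v (y ∷ []) (c ∷ []) | ascentᵇ-lastTwo v y c | y≺c | mulS-lastTwo v y c =
  ⊕-cong (gammaSum-freezeLast v c y K) (q·-cong (gammaSum-freezeLast v y c K))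

sweep-blocked : ∀ v y c K → (y ≺ᵇ c) ≡ false → gammaSum (topRow (suc (length v))) ((v ++ y ∷ []) ++ c ∷ []) K ≈P 0ₚ
sweep-blocked v y c K y⊀c rewrite ++-assoc v (y ∷ []) (c ∷ []) | ascentᵇ-lastTwo v y c | y⊀c = ≈P-refl

-- The continuation applied once the top row is done: the first entry is
-- then frozen and a suffix t of already frozen entries is reattached.
after : (List ℤ → Poly) → List ℤ → List ℤ → Poly
after H t u = H (drop 1 u ++ t)

gammaSum-after-∷ʳ : ∀ H t y v c →
  gammaSum (topRow (length v)) (v ++ c ∷ []) (λ u → after H t (u ++ y ∷ [])) ≈P
  gammaSum (topRow (length v)) (v ++ c ∷ []) (after H (y ∷ t))
gammaSum-after-∷ʳ H t y v c =
  gammaSum-congᴵ (Window (λ _ → ⊤) (suc (length v))) (topRow (length v)) (Window-invariant _ _) (v ++ c ∷ [])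
    (Window-⊤ v c) λ { (x ∷ u) _ → ≈P-reflexive (cong H (++-assoc u (y ∷ []) t)) }

gammaSum-after-zero : ∀ H t v c → (∀ s → H (s ++ t) ≈P 0ₚ) →
  gammaSum (topRow (length v)) (v ++ c ∷ []) (after H t) ≈P 0ₚ
gammaSum-after-zero H t v c H≈0 =
  gammaSum-zeroᴵ (Window (λ _ → ⊤) (suc (length v))) (topRow (length v)) (Window-invariant _ _) (v ++ c ∷ [])
    (Window-⊤ v c) (λ u _ → H≈0 (drop 1 u))

sweep-nonRecord : ∀ k v c K → length v ≡ k → All Positive v → suc c ≤ runningMax 0 v →
  gammaSum (topRow (length v)) (v ++ + suc c ∷ []) K ≈P 0ₚ
sweep-nonRecord zero    []  c K _   _  ()
sweep-nonRecord (suc k) v   c K len pv c<max with initLast v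
... | []      = contradiction len λ ()
... | v′ ∷ʳ′ y with All.∷ʳ⁻ pv
... | pv′ , pos a rewrite length-∷ʳ v′ (+ suc a) with a <ᵇ c in a<ᵇc
...   | false = sweep-blocked v′ (+ suc a) (+ suc c) K a<ᵇc
...   | true  with runningMax 0 v′ <ᵇ suc a in max<ᵇa | runningMax-∷ʳ v′ (suc a)
...     | true  | max≡a = contradiction (subst (suc c ≤_) max≡a c<max) (<⇒≱ (s≤s (<ᵇ≡true⇒< a<ᵇc)))
...     | false | max≡  = ≈P-trans (sweep-ascent v′ (+ suc a) (+ suc c) K a<ᵇc) (⊕-q·-zero
    (sweep-nonRecord k v′ c _ (suc-injective len) pv′ (subst (suc c ≤_) max≡ c<max))
    (sweep-nonRecord k v′ a _ (suc-injective len) pv′ (<ᵇ≡false⇒≥ max<ᵇa)))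

private
  records-newMax : ∀ u c t → All (Below (suc c)) u → All (Below (suc c)) t →
    records 0 ((u ++ + suc c ∷ []) ++ t) ≡ suc (records 0 u)
  records-newMax u c t u<c t<c
    rewrite ++-assoc u (+ suc c ∷ []) t | records-++ 0 u (+ suc c ∷ t)
          | <⇒<ᵇ≡true (runningMax-< 0 u (s≤s z≤n) u<c)
          | records-≡0 (suc c) t (All.map (Below-mono (n≤1+n _)) t<c) = +-comm (records 0 u) 1

sweep-record : ∀ k v c t g → length v ≡ k → All Positive v → All (Below (suc c)) v → All (Below (suc c)) t →
  gammaSum (topRow (length v)) (v ++ + suc c ∷ []) (after (g ∘ records 0) t) ≈P
  (g (records 0 (v ++ t)) ⊕ ψ g (records 0 v))
sweep-record zero    []  c t g _   _  _   _   = ≈P-sym (⊕-identityʳ _)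
sweep-record (suc k) v   c t g len pv v<c t<c with initLast v
... | []      = contradiction len λ ()
... | v′ ∷ʳ′ y with All.∷ʳ⁻ pv | All.∷ʳ⁻ v<c
... | pv′ , pos a | v′<c , below (s≤s a<c) rewrite length-∷ʳ v′ (+ suc a) = begin
  gammaSum (topRow (suc (length v′))) ((v′ ++ y′ ∷ []) ++ + suc c ∷ []) K
    ≈⟨ sweep-ascent v′ y′ (+ suc c) K (<⇒<ᵇ≡true a<c) ⟩
  gammaSum (topRow (length v′)) (v′ ++ + suc c ∷ []) (λ u → K (u ++ y′ ∷ [])) ⊕ q· Y
    ≈⟨ ⊕-congʳ (q· Y) stay ⟩
  (A ⊕ ψ g h′) ⊕ q· Y
    ≈⟨ move ⟩
  A ⊕ ψ g (records 0 (v′ ++ y′ ∷ []))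
    ∎
  where
  open ≈P-Reasoning
  y′ = + suc a
  h′ = records 0 v′
  K = after (g ∘ records 0) t
  A = g (records 0 ((v′ ++ y′ ∷ []) ++ t))
  Y = gammaSum (topRow (length v′)) (v′ ++ y′ ∷ []) (λ u → K (u ++ + suc c ∷ []))
  stay : gammaSum (topRow (length v′)) (v′ ++ + suc c ∷ []) (λ u → K (u ++ y′ ∷ [])) ≈P (A ⊕ ψ g h′)
  stay = ≈P-trans (gammaSum-after-∷ʳ (g ∘ records 0) t y′ v′ (+ suc c))
           (≈P-trans (sweep-record k v′ c (y′ ∷ t) g (suc-injective len) pv′ v′<c (below (s≤s a<c) ∷ t<c))
             (≈P-reflexive (cong (λ w → g (records 0 w) ⊕ ψ g h′) (sym (++-assoc v′ (y′ ∷ []) t)))))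
  -- After the swap y′ continues the sweep, which survives only if y′ exceeds all of v′.
  move : ((A ⊕ ψ g h′) ⊕ q· Y) ≈P (A ⊕ ψ g (records 0 (v′ ++ y′ ∷ [])))
  move with runningMax 0 v′ <ᵇ suc a in max<ᵇa
  ... | true  = begin
    (A ⊕ ψ g h′) ⊕ q· Y                                  ≈⟨ ⊕-congˡ (A ⊕ ψ g h′) (q·-cong (≈P-trans shifted moved)) ⟩
    (A ⊕ ψ g h′) ⊕ q· (g (suc h′) ⊕ ψ (g ∘ suc) h′)      ≈⟨ ⊕-assoc A (ψ g h′) _ ⟩
    A ⊕ ψ g (suc h′)                                     ≡⟨ cong (λ m → A ⊕ ψ g m) (records-∷ʳ-record v′ (suc a) (<ᵇ≡true⇒< max<ᵇa)) ⟨
    A ⊕ ψ g (records 0 (v′ ++ y′ ∷ []))                  ∎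
    where
    shifted : Y ≈P gammaSum (topRow (length v′)) (v′ ++ y′ ∷ []) (after (g ∘ suc ∘ records 0) [])
    shifted = gammaSum-congᴵ (Window (Below (suc c)) (suc (length v′))) (topRow (length v′)) (Window-invariant _ _)
      (v′ ++ y′ ∷ []) (Window-∷ʳ v′ y′ v′<c (below (s≤s a<c)))
      λ { (x ∷ u) (_ , _ ∷ u<c) → ≈P-reflexive (cong g (trans (records-newMax u c t u<c t<c)
                                                               (cong (suc ∘ records 0) (sym (++-identityʳ u))))) }
    moved : gammaSum (topRow (length v′)) (v′ ++ y′ ∷ []) (after (g ∘ suc ∘ records 0) []) ≈P (g (suc h′) ⊕ ψ (g ∘ suc) h′)
    moved = ≈P-trans (sweep-record k v′ a [] (g ∘ suc) (suc-injective len) pv′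
                        (All.map (Below-mono (<ᵇ≡true⇒< max<ᵇa)) (Below-runningMax 0 v′ pv′)) [])
                     (≈P-reflexive (cong (λ w → g (suc (records 0 w)) ⊕ ψ (g ∘ suc) h′) (++-identityʳ v′)))
  ... | false = begin
    (A ⊕ ψ g h′) ⊕ q· Y                   ≈⟨ ⊕-congˡ (A ⊕ ψ g h′) (≈P-trans (q·-cong blocked) q·-zero) ⟩
    (A ⊕ ψ g h′) ⊕ 0ₚ                     ≈⟨ ⊕-identityʳ (A ⊕ ψ g h′) ⟩
    A ⊕ ψ g h′                            ≡⟨ cong (λ m → A ⊕ ψ g m) (records-∷ʳ-nonRecord v′ (suc a) (<ᵇ≡false⇒≥ max<ᵇa)) ⟨
    A ⊕ ψ g (records 0 (v′ ++ y′ ∷ []))   ∎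
    where
    blocked : Y ≈P 0ₚ
    blocked = sweep-nonRecord k v′ a _ (suc-injective len) pv′ (<ᵇ≡false⇒≥ max<ᵇa)

startValue : (ℕ → Poly) → List ℤ → Poly
startValue b s = if hasNeg s then 0ₚ else b (records 0 s)

private
  gammaSum-frozenNeg : ∀ b t a v c →
    gammaSum (topRow (length v)) (v ++ c ∷ []) (λ u → after (startValue b) t (u ++ -[1+ a ] ∷ [])) ≈P 0ₚ
  gammaSum-frozenNeg b t a v c = ≈P-trans (gammaSum-after-∷ʳ (startValue b) t -[1+ a ] v c)
    (gammaSum-after-zero (startValue b) (-[1+ a ] ∷ t) v c λ s → ≈P-reflexive (cong (if_then 0ₚ else b (records 0 (s ++ -[1+ a ] ∷ t))) (hasNeg-middle s a t)))

sweep-negative : ∀ k v c t b → length v ≡ k → All Positive v → All Positive t →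
  gammaSum (topRow (length v)) (v ++ -[1+ c ] ∷ []) (after (startValue b) t) ≈P b (records 0 (v ++ t))
sweep-negative zero    []  c t b _   _  pt rewrite hasNeg-positive t pt = ≈P-refl
sweep-negative (suc k) v   c t b len pv pt with initLast v
... | []      = contradiction len λ ()
... | v′ ∷ʳ′ y with All.∷ʳ⁻ pv
... | pv′ , pos a rewrite length-∷ʳ v′ (+ suc a) = begin
  gammaSum (topRow (suc (length v′))) ((v′ ++ y′ ∷ []) ++ -[1+ c ] ∷ []) K
    ≈⟨ sweep-ascent v′ y′ -[1+ c ] K refl ⟩
  gammaSum (topRow (length v′)) (v′ ++ -[1+ c ] ∷ []) (λ u → K (u ++ y′ ∷ []))
  ⊕ q· gammaSum (topRow (length v′)) (v′ ++ y′ ∷ []) (λ u → K (u ++ -[1+ c ] ∷ []))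
    ≈⟨ ⊕-cong (gammaSum-after-∷ʳ (startValue b) t y′ v′ -[1+ c ])
              (≈P-trans (q·-cong (gammaSum-frozenNeg b t c v′ y′)) q·-zero) ⟩
  gammaSum (topRow (length v′)) (v′ ++ -[1+ c ] ∷ []) (after (startValue b) (y′ ∷ t)) ⊕ 0ₚ
    ≈⟨ ⊕-identityʳ _ ⟩
  gammaSum (topRow (length v′)) (v′ ++ -[1+ c ] ∷ []) (after (startValue b) (y′ ∷ t))
    ≈⟨ sweep-negative k v′ c (y′ ∷ t) b (suc-injective len) pv′ (pos a ∷ pt) ⟩
  b (records 0 (v′ ++ y′ ∷ t))
    ≡⟨ cong (b ∘ records 0) (++-assoc v′ (y′ ∷ []) t) ⟨
  b (records 0 ((v′ ++ y′ ∷ []) ++ t))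
    ∎
  where
  open ≈P-Reasoning
  y′ = + suc a
  K = after (startValue b) t

sweep-hasNeg : ∀ k v d t b → length v ≡ k → All Nonzero v → Nonzero d → hasNeg v ≡ true →
  gammaSum (topRow (length v)) (v ++ d ∷ []) (after (startValue b) t) ≈P 0ₚ
sweep-hasNeg zero    []  d t b _   _  _  ()
sweep-hasNeg (suc k) v   d t b len nv nd neg with initLast v
... | []      = contradiction len λ ()
... | v′ ∷ʳ′ y with All.∷ʳ⁻ nv
... | nv′ , nz⁻ a rewrite length-∷ʳ v′ -[1+ a ] with -[1+ a ] ≺ᵇ d in y≺d
...   | false = sweep-blocked v′ -[1+ a ] d (after (startValue b) t) y≺d
...   | true  with d
...     | -[1+ e ] = ≈P-trans (sweep-ascent v′ -[1+ a ] -[1+ e ] (after (startValue b) t) y≺d)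
                       (⊕-q·-zero (gammaSum-frozenNeg b t a v′ -[1+ e ]) (gammaSum-frozenNeg b t e v′ -[1+ a ]))
sweep-hasNeg (suc k) v d t b len nv nd neg | v′ ∷ʳ′ y | nv′ , nz⁺ a rewrite length-∷ʳ v′ (+ suc a)
  with + suc a ≺ᵇ d in y≺d
... | false = sweep-blocked v′ (+ suc a) d (after (startValue b) t) y≺d
... | true  = ≈P-trans (sweep-ascent v′ (+ suc a) d (after (startValue b) t) y≺d) (⊕-q·-zero
  (≈P-trans (gammaSum-after-∷ʳ (startValue b) t (+ suc a) v′ d)
            (sweep-hasNeg k v′ d (+ suc a ∷ t) b (suc-injective len) nv′ nd neg′))
  (≈P-trans (gammaSum-after-∷ʳ (startValue b) t d v′ (+ suc a))
            (sweep-hasNeg k v′ (+ suc a) (d ∷ t) b (suc-injective len) nv′ (nz⁺ a) neg′)))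
  where neg′ = trans (sym (hasNeg-∷ʳ-+ v′ (suc a))) neg

gammaPoly : ℕ → Poly
gammaPoly j = gammaSum (readingWord j) (idW j) (λ _ → 1ₚ)

-- Started from any signed permutation w instead of the identity, the
-- Γ-condition forces w to be positive, and then only the number of
-- left-to-right maxima of w matters.
StartFormula : ℕ → Set
StartFormula m = ∀ w → length w ≡ m → All Nonzero w →
  gammaSum (readingWord m) w (λ _ → 1ₚ) ≈P startValue gammaPoly w

gammaSum-readingWord-suc : ∀ m → StartFormula m → ∀ w → length w ≡ suc m → All Nonzero w →
  gammaSum (readingWord (suc m)) w (λ _ → 1ₚ) ≈P gammaSum (topRow (suc m)) w (after (startValue gammaPoly) [])
gammaSum-readingWord-suc m formula w len nw =
  ≈P-trans (gammaSum-++ (topRow (suc m)) (map suc (readingWord m)) w (λ _ → 1ₚ))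
    (gammaSum-congᴵ (Window Nonzero (suc m)) (topRow (suc m)) nonzeroInvariant w (len , nw) rest)
  where
  nonzeroInvariant : Invariant (Window Nonzero (suc m)) (topRow (suc m))
  nonzeroInvariant = All.universal (λ i u (len , nu) → trans (length-mulS i u) len , All-Nonzero-mulS i u nu) _
  rest : ∀ u → Window Nonzero (suc m) u →
    gammaSum (map suc (readingWord m)) u (λ _ → 1ₚ) ≈P after (startValue gammaPoly) [] u
  rest (x ∷ u) (len , _ ∷ nu) rewrite ++-identityʳ u =
    ≈P-trans (gammaSum-map-suc (readingWord m) x u (λ _ → 1ₚ) (All.map proj₁ (ValidWord-readingWord m)))
             (formula u (suc-injective len) nu)

sweep-sign : ∀ v x K → gammaSum (topRow (suc (length v))) (v ++ x ∷ []) K ≈P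
  (if isNonNeg x then gammaSum (topRow (length v)) (v ++ - x ∷ []) K ⊕ q· gammaSum (topRow (length v)) (v ++ x ∷ []) K
                 else 0ₚ)
sweep-sign v x K rewrite ascentᵇ-last v x | mulS-last v x = ≈P-refl

readingWord-positive : ∀ m → StartFormula m → ∀ v c → length v ≡ m → All Positive v →
  gammaSum (readingWord (suc m)) (v ++ + suc c ∷ []) (λ _ → 1ₚ) ≈P
  (gammaPoly (records 0 v) ⊕ q· (if runningMax 0 v <ᵇ suc c then gammaPoly (records 0 v) ⊕ ψ gammaPoly (records 0 v) else 0ₚ))
readingWord-positive m formula v c refl pv = begin
  gammaSum (readingWord (suc (length v))) (v ++ + suc c ∷ []) (λ _ → 1ₚ)
    ≈⟨ gammaSum-readingWord-suc (length v) formula (v ++ + suc c ∷ []) (length-∷ʳ v _)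
         (All.∷ʳ⁺ (All.map (λ { (pos a) → nz⁺ a }) pv) (nz⁺ c)) ⟩
  gammaSum (topRow (suc (length v))) (v ++ + suc c ∷ []) K
    ≈⟨ sweep-sign v (+ suc c) K ⟩
  gammaSum (topRow (length v)) (v ++ -[1+ c ] ∷ []) K ⊕ q· gammaSum (topRow (length v)) (v ++ + suc c ∷ []) K
    ≈⟨ ⊕-cong negated (q·-cong (≈P-trans positiveStart kept)) ⟩
  gammaPoly h ⊕ q· (if runningMax 0 v <ᵇ suc c then gammaPoly h ⊕ ψ gammaPoly h else 0ₚ)
    ∎
  where
  open ≈P-Reasoning
  K = after (startValue gammaPoly) []
  h = records 0 v
  negated : gammaSum (topRow (length v)) (v ++ -[1+ c ] ∷ []) K ≈P gammaPoly h
  negated = ≈P-trans (sweep-negative (length v) v c [] gammaPoly refl pv [])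
                     (≈P-reflexive (cong (gammaPoly ∘ records 0) (++-identityʳ v)))
  positiveStart : gammaSum (topRow (length v)) (v ++ + suc c ∷ []) K ≈P
                  gammaSum (topRow (length v)) (v ++ + suc c ∷ []) (after (gammaPoly ∘ records 0) [])
  positiveStart = gammaSum-congᴵ (Window Positive (suc (length v))) (topRow (length v)) (Window-invariant _ _)
    (v ++ + suc c ∷ []) (Window-∷ʳ v _ pv (pos c))
    λ { (x ∷ u) (_ , _ ∷ pu) → ≈P-reflexive (cong (if_then 0ₚ else gammaPoly (records 0 (u ++ []))) (hasNeg-positive (u ++ []) (All.++⁺ pu []))) }
  kept : gammaSum (topRow (length v)) (v ++ + suc c ∷ []) (after (gammaPoly ∘ records 0) []) ≈P
         (if runningMax 0 v <ᵇ suc c then gammaPoly h ⊕ ψ gammaPoly h else 0ₚ)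
  kept with runningMax 0 v <ᵇ suc c in max<ᵇc
  ... | true  = ≈P-trans (sweep-record (length v) v c [] gammaPoly refl pv
                            (All.map (Below-mono (<ᵇ≡true⇒< max<ᵇc)) (Below-runningMax 0 v pv)) [])
                         (≈P-reflexive (cong (λ w → gammaPoly (records 0 w) ⊕ ψ gammaPoly h) (++-identityʳ v)))
  ... | false = sweep-nonRecord (length v) v c _ refl pv (<ᵇ≡false⇒≥ max<ᵇc)

readingWord-hasNeg : ∀ m → StartFormula m → ∀ w → length w ≡ suc m → All Nonzero w → hasNeg w ≡ true →
  gammaSum (readingWord (suc m)) w (λ _ → 1ₚ) ≈P 0ₚ
readingWord-hasNeg m formula w len nw neg with initLast w
... | []     = contradiction len λ ()
... | v ∷ʳ′ x with All.∷ʳ⁻ nw | suc-injective (trans (sym (length-∷ʳ v x)) len)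
... | nv , nz⁻ a | refl = ≈P-trans (gammaSum-readingWord-suc (length v) formula (v ++ x ∷ []) len nw)
                                   (sweep-sign v x (after (startValue gammaPoly) []))
... | nv , nz⁺ a | refl = ≈P-trans (gammaSum-readingWord-suc (length v) formula (v ++ x ∷ []) len nw)
  (≈P-trans (sweep-sign v x (after (startValue gammaPoly) []))
    (⊕-q·-zero (sweep-hasNeg (length v) v -[1+ a ] [] gammaPoly refl nv (nz⁻ a) neg′)
               (sweep-hasNeg (length v) v (+ suc a) [] gammaPoly refl nv (nz⁺ a) neg′)))
  where neg′ = trans (sym (hasNeg-∷ʳ-+ v (suc a))) neg

gammaPoly-suc : ∀ h → StartFormula h → gammaPoly (suc h) ≈P (gammaPoly h ⊕ q· (gammaPoly h ⊕ ψ gammaPoly h))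
gammaPoly-suc h formula with max≡h , rec≡h , pv ← idW-records h =
  subst (λ w → gammaSum (readingWord (suc h)) w (λ _ → 1ₚ) ≈P (gammaPoly h ⊕ q· (gammaPoly h ⊕ ψ gammaPoly h)))
        (sym (idW-suc h))
        (≈P-trans (readingWord-positive h formula (idW h) h (trans (length-map _ (upTo h)) (length-upTo h)) pv)
                  (≈P-reflexive (cong₂ (λ r b → gammaPoly r ⊕ q· (if b then gammaPoly r ⊕ ψ gammaPoly r else 0ₚ))
                                       rec≡h (trans (cong (_<ᵇ suc h) max≡h) (<⇒<ᵇ≡true (n<1+n h))))))

startFormula : ∀ m → StartFormula m
startFormula = <-rec StartFormula step
  where
  positive : ∀ v → All Nonzero v → hasNeg v ≡ false → All Positive v
  positive []                []           _   = []
  positive (.(+ suc a) ∷ v) (nz⁺ a ∷ nv) neg = pos a ∷ positive v nv neg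
  step : ∀ m → (∀ {j} → j < m → StartFormula j) → StartFormula m
  step zero    _  []    _   _  = ≈P-refl
  step (suc m) ih w len nw with hasNeg w in neg
  ... | true  = readingWord-hasNeg m (ih ≤-refl) w len nw neg
  ... | false with initLast w
  ...   | []     = contradiction len λ ()
  ...   | v ∷ʳ′ x with All.∷ʳ⁻ nw | suc-injective (trans (sym (length-∷ʳ v x)) len)
  ...     | nv , nz⁻ a | _    = contradiction (trans (sym (hasNeg-middle v a [])) neg) λ ()
  ...     | nv , nz⁺ c | refl = ≈P-trans (readingWord-positive (length v) (ih ≤-refl) v c refl pv) recurse
    where
    pv = positive v nv (trans (sym (hasNeg-∷ʳ-+ v (suc c))) neg)
    h = records 0 v
    recurse : (gammaPoly h ⊕ q· (if runningMax 0 v <ᵇ suc c then gammaPoly h ⊕ ψ gammaPoly h else 0ₚ))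
              ≈P gammaPoly (records 0 (v ++ + suc c ∷ []))
    recurse with runningMax 0 v <ᵇ suc c in max<ᵇc
    ... | true  rewrite records-∷ʳ-record v (suc c) (<ᵇ≡true⇒< max<ᵇc) =
      ≈P-sym (gammaPoly-suc h (ih (s≤s (records-≤-length 0 v))))
    ... | false rewrite records-∷ʳ-nonRecord v (suc c) (<ᵇ≡false⇒≥ max<ᵇc) =
      ≈P-trans (⊕-congˡ (gammaPoly h) q·-zero) (⊕-identityʳ (gammaPoly h))

gammaGenPoly≈gammaPoly : ∀ n p → IsGammaGenPoly n p → p ≈P gammaPoly n
gammaGenPoly≈gammaPoly n p gen k = begin
  p k                                                     ≡⟨ HasCount-unique (gen k) counted (Unique.filter⁺ (T? ∘ counts) (allVecs-unique (boxes n))) membership ⟩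
  length counted                                          ≡⟨ count≡gammaSum (revLinExt n) (idW n) k ⟩
  gammaSum (map label (revLinExt n)) (idW n) (λ _ → 1ₚ) k ≡⟨ cong (λ l → gammaSum l (idW n) (λ _ → 1ₚ) k) (labels-revLinExt n) ⟩
  gammaPoly n k                                           ∎
  where
  open ≡-Reasoning
  counts = isCounted (revLinExt n) (idW n) k
  counted = filterᵇ counts (allVecs (boxes n))
  labels = map label (revLinExt n)
  valid : ValidWord n labels
  valid = subst (ValidWord n) (sym (labels-revLinExt n)) (ValidWord-readingWord n)
  membership : ∀ D → (D ∈ counted) ⇔ (IsGamma n D × plusCount (Vec.toList D) ≡ k)
  membership D = mk⇔ to from
    where
    to : D ∈ counted → IsGamma n D × plusCount (Vec.toList D) ≡ k
    to D∈ with γ , pk ← Equivalence.to T-∧ (proj₂ (∈-filter⁻ (T? ∘ counts) {xs = allVecs (boxes n)} D∈)) =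
      gammaᵇ⇒GammaFrom labels (Vec.toList D) (idW n) (IsSignedPerm-idW n) valid (Equivalence.to T-≡ γ) ,
      ≡ᵇ⇒≡ _ _ pk
    from : IsGamma n D × plusCount (Vec.toList D) ≡ k → D ∈ counted
    from (γ , pk) = ∈-filter⁺ (T? ∘ counts) (allVecs-complete (boxes n) D) (Equivalence.from T-∧
      (Equivalence.from T-≡ (GammaFrom⇒gammaᵇ labels (Vec.toList D) (idW n) (IsSignedPerm-idW n) valid γ) ,
       ≡⇒≡ᵇ _ _ pk))

mainTheorem15 : (b : ℕ → Poly) → b 0 ≈P qpow 0 →
    (∀ n → 1 ≤ n → IsGammaGenPoly n (b n)) →
    ∀ n → 1 ≤ n → b n ≈P recRHS b n
mainTheorem15 b b0 gen (suc h) _ = begin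
  b (suc h)                                        ≈⟨ b≈gammaPoly (suc h) ⟩
  gammaPoly (suc h)                                ≈⟨ gammaPoly-suc h (startFormula h) ⟩
  gammaPoly h ⊕ q· (gammaPoly h ⊕ ψ gammaPoly h)   ≈⟨ recRHS-suc gammaPoly h ⟨
  recRHS gammaPoly (suc h)                         ≈⟨ recRHS-cong b≈gammaPoly (suc h) ⟨
  recRHS b (suc h)                                 ∎
  where
  open ≈P-Reasoning
  b≈gammaPoly : ∀ m → b m ≈P gammaPoly m
  b≈gammaPoly zero    = b0
  b≈gammaPoly (suc m) = gammaGenPoly≈gammaPoly (suc m) (b (suc m)) (gen (suc m) (s≤s z≤n))
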